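{- Let $n\ge1$. The map $\xi$ is an involution on $\mathrm{NC}(n)$ with $\operatorname{type}(\xi(\pi))=\operatorname{type}(\pi)$, $\operatorname{nn}(\xi(\pi))=\operatorname{na}(\pi)$ and $\operatorname{na}(\xi(\pi))=\operatorname{nn}(\pi)$ for all $\pi\in\mathrm{NC}(n)$. Moreover, if $\{N_1,\dots,N_r\}_<$ and $\{N'_1,\dots,N'_s\}_<$ are the sets of nonnested blocks of $\pi$ and $\xi(\pi)$ respectively, and $\{A_1,\dots,A_s\}_<$ and $\{A'_1,\dots,A'_r\}_<$ are the sets of nonaligned blocks of $\pi$ and $\xi(\pi)$ respectively, then $|N_i|=|A'_i|$ for all $i\in[r]$ and $|A_j|=|N'_j|$ for all $j\in[s]$.
   Context: $[n]=\{1,\dots,n\}$. An edge of a partition of $[n]$ is a pair $(i,j)$, $i<j$, in the same block with no element of that block strictly between. $\mathrm{NC}(n)$ is the set of partitions of $[n]$ with no two edges $(a,b),(c,d)$, $a<c<b<d$; $\mathrm{NC}(0)=\{\emptyset\}$. A block $B$ of $\pi$ is nonnested if there is no edge $(i,j)$ with $i<\min B\le\max B<j$, and nonaligned if there is no edge $(i,j)$ with $\max B<i$; $\operatorname{nn}(\pi)$, $\operatorname{na}(\pi)$ are their numbers. The type of $\pi$ is the multiset of block sizes. $\{A_1,\dots,A_k\}_<$ means $\max A_1<\cdots<\max A_k$. Operations: for $\sigma\in\mathrm{NC}(a)$, $\tau\in\mathrm{NC}(b)$ ($a,b\ge0$), $\sigma\uplus\tau\in\mathrm{NC}(a+b)$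 consists of the blocks of $\sigma$ and the blocks of $\tau$ with all elements increased by $a$. $\sigma\in\mathrm{NC}(a)$, $a\ge1$, is connected if $1$ and $a$ lie in one block. For $\sigma\in\mathrm{NC}(a)$ connected or $\sigma=\emptyset$, and $\tau\in\mathrm{NC}(b)$, $\sigma*\tau\in\mathrm{NC}(a+b+1)$ is obtained from $\sigma\uplus\tau$ by adding $a+b+1$ to the block containing $a$ if $a\ge1$, and as a new singleton block if $\sigma=\emptyset$. For $\pi\in\mathrm{NC}(n)$ and $S=\{s_1<\cdots<s_k\}\subseteq[n]$, $\pi\cap S\in\mathrm{NC}(k)$ is obtained by restricting $\pi$ to $S$ and replacing $s_i$ by $i$. If $\{n\}$ is not a block of $\pi\in\mathrm{NC}(n)$, let $B$ be the block containing $n$, $a=\min B$, $b$ the second largest element of $B$; then $\pi=\sigma\uplus(\tau*\upsilon)$ with $\sigma=\pi\cap[1,a-1]$, $\tau=\pi\cap[a,b]$ (connected), $\upsilon=\pi\cap[b+1,n-1]$, and we set $\mathrm{decomp}_1(\pi)=\mathrm{decomp}_2(\pi)=(\sigma,\tau,\upsilon)$. If $\{n\}$ is a block, $\mathrm{decomp}_1(\pi)=(\pi\cap[n-1],\emptyset,\emptyset)$ and $\mathrm{decomp}_2(\pi)=(\emptyset,\emptyset,\pi\cap[n-1])$. Definition of $\xi$: first let $\pi\in\mathrm{NC}(n)$ with $\{n\}$ not a block. Put $\pi_1=\pi$ and $(\pi_{i+1},\sigma_i,\sigma'_i)=\mathrm{decomp}_1(\pi_i)$ while $\pi_i\neq\emptyset$,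 and let $r$ be such that $\pi_{r+1}=\emptyset$. Put $\upsilon_1=\pi$ and $(\tau'_i,\tau_i,\upsilon_{i+1})=\mathrm{decomp}_2(\upsilon_i)$ while $\upsilon_i\ne\emptyset$, and let $s$ be such that $\upsilon_{s+1}=\emptyset$ (note $\sigma_1=\tau_1$). Let $M_{r+1}=\emptyset$ and $M_i=\sigma'_i\uplus(\sigma_i*M_{i+1})$ for $i=r,r-1,\dots,2$. Then $\xi(\pi)=(\tau_s*\tau'_s)\uplus\cdots\uplus(\tau_2*\tau'_2)\uplus(\sigma_1*M_2)$. For general $\pi\in\mathrm{NC}(n)$, let $k$ be the largest element of $[n]$ such that $\{k\}$ is not a block of $\pi$; then $\xi(\pi)$ is $\xi(\pi\cap[k])$ together with the singleton blocks $\{k+1\},\dots,\{n\}$ (if all blocks of $\pi$ are singletons, $\xi(\pi)=\pi$). -}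

module Defs where

open import Data.Nat using (ℕ; zero; suc; _+_; _∸_; _≤_; _<_; _⊔_; _⊓_; _≤ᵇ_; _<ᵇ_; _≡ᵇ_)
open import Data.Bool using (Bool; true; false; _∧_; not; if_then_else_)
open import Data.Maybe using (Maybe; just; nothing)
open import Data.Product using (_×_; _,_; proj₁; proj₂)
open import Data.List using (List; []; _∷_; _++_; map; foldr; foldl; concat; concatMap; length; null; filterᵇ; upTo)
open import Data.Bool.ListAction using (any)
open import Data.List.Membership.Propositional using (_∈_)
open import Data.List.Relation.Unary.All using (All)
open import Data.List.Relation.Unary.AllPairs using (AllPairs)
open import Data.List.Relation.Unary.Unique.Propositional using (Unique)
open import Relation.Nullary using (¬_)
open import Relation.Binary.PropositionalEquality using (_≡_; _≢_)
open import Function.Bundles using (_⇔_)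

-- We work with the canonical representative: every block is listed in
-- strictly increasing order, and the blocks are listed in strictly
-- increasing order of their maxima.  With this convention two
-- partitions are equal as set partitions iff they are equal (≡) as
-- lists of lists.

Block : Set
Block = List ℕ

-- a "sized" partition: (n , blocks), i.e. a partition of [n]
Part : Set
Part = ℕ × List Block

maxB : Block → ℕ
maxB = foldr _⊔_ 0

minB : Block → ℕ
minB []       = 0
minB (x ∷ xs) = foldr _⊓_ x xs

record IsPartition (n : ℕ) (bs : List Block) : Set where
  field
    nonempty   : All (λ B → B ≢ []) bs
    increasing : All (AllPairs _<_) bs
    ordered    : AllPairs _<_ (map maxB bs)
    disjoint   : Unique (concat bs)
    covers     : ∀ i → (i ∈ concat bs) ⇔ ((1 ≤ i) × (i ≤ n))

consec : Block → List (ℕ × ℕ)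
consec (x ∷ y ∷ xs) = (x , y) ∷ consec (y ∷ xs)
consec _            = []

edges : List Block → List (ℕ × ℕ)
edges = concatMap consec

Noncrossing : List Block → Set
Noncrossing bs = ∀ {a b c d} → (a , b) ∈ edges bs → (c , d) ∈ edges bs →
                 ¬ ((a < c) × (c < b) × (b < d))

record IsNC (n : ℕ) (bs : List Block) : Set where
  field
    partition   : IsPartition n bs
    noncrossing : Noncrossing bs

-- type = multiset of block sizes (compared up to permutation)
type : List Block → List ℕ
type = map length

nonnested : List Block → Block → Bool
nonnested bs B = not (any (λ e → (proj₁ e <ᵇ minB B) ∧ (maxB B <ᵇ proj₂ e)) (edges bs))

nonaligned : List Block → Block → Bool
nonaligned bs B = not (any (λ e → maxB B <ᵇ proj₁ e) (edges bs))

-- the nonnested (resp. nonaligned) blocks, listed in increasing order of maxima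
nnBlocks naBlocks : List Block → List Block
nnBlocks bs = filterᵇ (nonnested bs) bs
naBlocks bs = filterᵇ (nonaligned bs) bs

nn na : List Block → ℕ
nn bs = length (nnBlocks bs)
na bs = length (naBlocks bs)

_∈ᵇ_ : ℕ → List ℕ → Bool
x ∈ᵇ xs = any (x ≡ᵇ_) xs

insertB : Block → List Block → List Block
insertB B []       = B ∷ []
insertB B (C ∷ cs) = if maxB B ≤ᵇ maxB C then B ∷ C ∷ cs else C ∷ insertB B cs

canon : List Block → List Block
canon = foldr insertB []

∅ₚ : Part
∅ₚ = 0 , []

shift : ℕ → List Block → List Block
shift a = map (map (a +_))

_⊎ₚ_ : Part → Part → Part
(a , σ) ⊎ₚ (b , τ) = a + b , canon (σ ++ shift a τ)

-- σ * τ  (σ connected or empty); a = 0 means σ = ∅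
_*ₚ_ : Part → Part → Part
(zero , σ) *ₚ (b , τ) = suc b , canon (τ ++ ((suc b ∷ []) ∷ []))
(suc a , σ) *ₚ (b , τ) =
  suc a + b + 1 ,
  canon (map (λ B → if suc a ∈ᵇ B then B ++ (suc a + b + 1 ∷ []) else B) σ ++ shift (suc a) τ)

-- π ∩ [l , r]  (l ≥ 1), renumbered to a partition of [r - l + 1]
restrict : Part → ℕ → ℕ → Part
restrict (n , bs) l r =
  (suc r ∸ l) ,
  canon (filterᵇ (λ B → not (null B))
          (map (λ B → map (_∸ (l ∸ 1)) (filterᵇ (λ x → (l ≤ᵇ x) ∧ (x ≤ᵇ r)) B)) bs))

findBlock : ℕ → List Block → Maybe Block
findBlock x []       = nothing
findBlock x (B ∷ bs) = if x ∈ᵇ B then just B else findBlock x bs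

singletonBlock : ℕ → List Block → Bool
singletonBlock x bs with findBlock x bs
... | nothing = false
... | just B  = length B ≡ᵇ 1

-- (σ , τ , υ) for π with {n} not a block, B the block containing n
decompGen : Part → Block → Part × Part × Part
decompGen π@(n , bs) B =
  restrict π 1 (a ∸ 1) , restrict π a b , restrict π (suc b) (n ∸ 1)
  where
  a = minB B
  b = maxB (filterᵇ (_<ᵇ n) B)

decomp₁ decomp₂ : Part → Part × Part × Part
decomp₁ π@(n , bs) with findBlock n bs
... | just B  = if length B ≡ᵇ 1 then (restrict π 1 (n ∸ 1) , ∅ₚ , ∅ₚ) else decompGen π B
... | nothing = (restrict π 1 (n ∸ 1) , ∅ₚ , ∅ₚ)
decomp₂ π@(n , bs) with findBlock n bs
... | just B  = if length B ≡ᵇ 1 then (∅ₚ , ∅ₚ , restrict π 1 (n ∸ 1)) else decompGen π B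
... | nothing = (∅ₚ , ∅ₚ , restrict π 1 (n ∸ 1))

-- [(σ₁ , σ'₁) , … , (σ_r , σ'_r)]; the size strictly decreases, so fuel n suffices
chain₁ : ℕ → Part → List (Part × Part)
chain₁ zero    π = []
chain₁ (suc f) (zero , bs) = []
chain₁ (suc f) π@(suc n , bs) with decomp₁ π
... | (π' , s , s') = (s , s') ∷ chain₁ f π'

chain₂ : ℕ → Part → List (Part × Part)
chain₂ zero    π = []
chain₂ (suc f) (zero , bs) = []
chain₂ (suc f) π@(suc n , bs) with decomp₂ π
... | (t' , t , υ') = (t , t') ∷ chain₂ f υ'

Mseq : List (Part × Part) → Part
Mseq []              = ∅ₚ
Mseq ((s , s') ∷ cs) = s' ⊎ₚ (s *ₚ Mseq cs)

-- ξ for π with {n} not a block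
ξcore : Part → Part
ξcore π = foldl (λ acc p → (proj₁ p *ₚ proj₂ p) ⊎ₚ acc) base (tail₂ (chain₂ (proj₁ π) π))
  where
  base : Part
  base with chain₁ (proj₁ π) π
  ... | []              = ∅ₚ
  ... | (σ₁ , _) ∷ rest = σ₁ *ₚ Mseq rest
  tail₂ : List (Part × Part) → List (Part × Part)
  tail₂ []       = []
  tail₂ (_ ∷ xs) = xs

lastNonSingleton : ℕ → List Block → Maybe ℕ
lastNonSingleton zero    bs = nothing
lastNonSingleton (suc k) bs =
  if singletonBlock (suc k) bs then lastNonSingleton k bs else just (suc k)

ξₚ : Part → Part
ξₚ π@(n , bs) with lastNonSingleton n bs
... | nothing = π
... | just k  = ξcore (restrict π 1 k) ⊎ₚ ((n ∸ k) , map (λ i → suc i ∷ []) (upTo (n ∸ k)))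

ξ : ℕ → List Block → List Block
ξ n bs = proj₂ (ξₚ (n , bs))

module Submission where

-- Strategy: replace partitions by a free syntax.  A noncrossing partition is
-- uniquely a ⊎-sum of connected components, and a connected partition is {1}
-- or τ * υ with τ connected; the terms Term / Conn record exactly this.  Their
-- denotation den is always a noncrossing partition (den-isNC) and every
-- noncrossing partition is one (den-surjective).  On denotations ⊎, * and
-- decomp₁ / decomp₂ act syntactically, so ξ is a syntactic map ξS (ξ-hom) with
--   ξS (p ▷ K * q) = unchain (chain₂ q) ▷ K * Mseq (chain₁ p)
-- (trailing singletons untouched, ξcoreS-form).  Chains and reassemblies are
-- mutually inverse, so ξS is an involution preserving size and type; the
-- nonnested blocks of den p are the outer blocks of its components and the
-- nonaligned ones are read off its last component, which yields the exchange.

open import Defs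
open import Data.Nat using (ℕ; zero; suc; _+_; _∸_; _≤_; _<_; _⊔_; _⊓_; _≤ᵇ_; _<ᵇ_; _≡ᵇ_; z≤n; s≤s)
open import Data.Nat.Properties
open import Data.Nat.Tactic.RingSolver using (solve-∀)
open import Data.Bool using (Bool; true; false; _∧_; _∨_; not; if_then_else_; T)
open import Data.Bool.Properties using (∨-identityʳ; ∨-zeroʳ; ∧-zeroʳ; ∨-assoc)
open import Data.Bool.ListAction using (any)
open import Data.Maybe using (Maybe; just; nothing)
open import Data.Product using (_×_; _,_; proj₁; proj₂; Σ)
open import Data.Sum using (_⊎_; inj₁; inj₂)
open import Data.Empty using (⊥; ⊥-elim)
open import Data.List using (List; []; _∷_; _++_; map; foldr; foldl; concat; length; null; filterᵇ; upTo; [_]; applyUpTo; _∷ʳ_)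
open import Data.List.Properties using (map-id; map-∘; map-cong; map-id-local; ∷ʳ-injective; map-++; ++-assoc; foldr-++; ++-identityʳ; length-map; length-++; concat-++; concat-map; applyUpTo-∷ʳ; concatMap-++)
open import Data.List.Relation.Unary.All using (All; []; _∷_) renaming (map to All-map)
import Data.List.Relation.Unary.All as All
import Data.List.Relation.Unary.All.Properties as AllP
open import Data.List.Relation.Unary.AllPairs using (AllPairs; []; _∷_)
import Data.List.Relation.Unary.AllPairs as AP
import Data.List.Relation.Unary.AllPairs.Properties as APP
open import Data.List.Relation.Unary.Any using (here; there)
open import Data.List.Membership.Propositional using (_∈_)
open import Data.List.Membership.Propositional.Properties using (∈-++⁺ʳ; ∈-++⁺ˡ; ∈-++⁻; ∈-map⁺; ∈-map⁻; ∈-concat⁻′; ∈-concat⁺′)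
open import Data.List.Relation.Unary.Unique.Propositional using (Unique)
import Data.List.Relation.Unary.Unique.Propositional.Properties as UP
open import Data.List.Relation.Binary.Permutation.Propositional using (_↭_; ↭-refl; ↭-sym; ↭-trans; ↭-reflexive; ↭⇒↭ₛ)
import Data.List.Relation.Binary.Permutation.Propositional.Properties as PermP
open PermP using (++⁺; ++⁺ˡ; ++⁺ʳ; ++-comm; shifts; ∈-resp-↭)
import Data.List.Relation.Binary.Permutation.Setoid.Properties as PermS
open import Relation.Nullary using (¬_)
open import Relation.Binary.Definitions using (tri<; tri≈; tri>)
open import Relation.Binary.PropositionalEquality hiding ([_])
open import Function using (_∘_; id)
open import Function.Bundles using (_⇔_; mk⇔; Equivalence)

shift-++ : ∀ c xs ys → shift c (xs ++ ys) ≡ shift c xs ++ shift c ys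
shift-++ c xs ys = map-++ (map (c +_)) xs ys

shift0 : ∀ bs → shift 0 bs ≡ bs
shift0 [] = refl
shift0 (B ∷ bs) = cong₂ _∷_ (map-id B) (shift0 bs)

shift-shift : ∀ a b bs → shift a (shift b bs) ≡ shift (a + b) bs
shift-shift a b bs = trans (sym (map-∘ bs))
  (map-cong (λ B → trans (sym (map-∘ B)) (map-cong (λ x → sym (+-assoc a b x)) B)) bs)

maxB-≤ : ∀ {m} xs → All (_≤ m) xs → maxB xs ≤ m
maxB-≤ [] [] = z≤n
maxB-≤ (x ∷ xs) (px ∷ pxs) = ⊔-lub px (maxB-≤ xs pxs)

∈-≤maxB : ∀ {x} xs → x ∈ xs → x ≤ maxB xs
∈-≤maxB (y ∷ xs) (here refl) = m≤m⊔n y (maxB xs)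
∈-≤maxB (y ∷ xs) (there p) = ≤-trans (∈-≤maxB xs p) (m≤n⊔m y (maxB xs))

maxB-eq : ∀ {m} xs → All (_≤ m) xs → m ∈ xs → maxB xs ≡ m
maxB-eq xs a i = ≤-antisym (maxB-≤ xs a) (∈-≤maxB xs i)

maxB∈' : ∀ x ys → maxB (x ∷ ys) ∈ (x ∷ ys)
maxB∈' x [] = here (⊔-identityʳ x)
maxB∈' x (y ∷ ys) with ≤-total x (maxB (y ∷ ys)) | maxB∈' y ys
... | inj₁ le | m = there (subst (_∈ (y ∷ ys)) (sym (m≤n⇒m⊔n≡n le)) m)
... | inj₂ ge | _ = here (m≥n⇒m⊔n≡m ge)

maxB∈ : ∀ B → B ≢ [] → maxB B ∈ B
maxB∈ [] ne = ⊥-elim (ne refl)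
maxB∈ (x ∷ ys) _ = maxB∈' x ys

maxB-shift : ∀ c B → B ≢ [] → maxB (map (c +_) B) ≡ c + maxB B
maxB-shift c [] ne = ⊥-elim (ne refl)
maxB-shift c (x ∷ []) ne = trans (⊔-identityʳ (c + x)) (cong (c +_) (sym (⊔-identityʳ x)))
maxB-shift c (x ∷ y ∷ B) ne = trans (cong ((c + x) ⊔_) (maxB-shift c (y ∷ B) (λ ())))
                                   (sym (+-distribˡ-⊔ c x (maxB (y ∷ B))))

minB-head : ∀ x xs → All (x ≤_) xs → foldr _⊓_ x xs ≡ x
minB-head x [] [] = refl
minB-head x (y ∷ xs) (l ∷ ls) rewrite minB-head x xs ls = m≥n⇒m⊓n≡n l

minB-shift : ∀ c B → B ≢ [] → minB (map (c +_) B) ≡ c + minB B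
minB-shift c [] ne = ⊥-elim (ne refl)
minB-shift c (x ∷ xs) _ = go xs
  where
  go : ∀ xs → foldr _⊓_ (c + x) (map (c +_) xs) ≡ c + foldr _⊓_ x xs
  go [] = refl
  go (y ∷ ys) = trans (cong ((c + y) ⊓_) (go ys)) (sym (+-distribˡ-⊓ c y _))

Between : ℕ → ℕ → ℕ → Set
Between lo hi x = lo ≤ x × x ≤ hi

InRange : ℕ → ℕ → List Block → Set
InRange lo hi bs = All (All (Between lo hi)) bs

NonEmptyAll : List Block → Set
NonEmptyAll = All (λ B → B ≢ [])

SortedB : List Block → Set
SortedB = AllPairs (λ B C → maxB B < maxB C)

Between-weaken : ∀ {lo hi lo' hi'} → lo' ≤ lo → hi ≤ hi' → ∀ {x} → Between lo hi x → Between lo' hi' x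
Between-weaken a b (c , d) = ≤-trans a c , ≤-trans d b

InRange-weaken : ∀ {lo hi lo' hi'} → lo' ≤ lo → hi ≤ hi' → ∀ {bs} → InRange lo hi bs → InRange lo' hi' bs
InRange-weaken a b r = All-map (All-map (Between-weaken a b)) r

InRange-shift : ∀ c {lo hi bs} → InRange lo hi bs → InRange (c + lo) (c + hi) (shift c bs)
InRange-shift c [] = []
InRange-shift c (r ∷ rs) = AllP.map⁺ (All-map (λ { (a , b) → +-monoʳ-≤ c a , +-monoʳ-≤ c b }) r) ∷ InRange-shift c rs

NonEmptyAll-shift : ∀ c {bs} → NonEmptyAll bs → NonEmptyAll (shift c bs)
NonEmptyAll-shift c [] = []
NonEmptyAll-shift c (_∷_ {[]} ne nes) = ⊥-elim (ne refl)
NonEmptyAll-shift c (_∷_ {x ∷ B} ne nes) = (λ ()) ∷ NonEmptyAll-shift c nes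

maxB-Between : ∀ {lo hi} B → B ≢ [] → All (Between lo hi) B → Between lo hi (maxB B)
maxB-Between [] ne _ = ⊥-elim (ne refl)
maxB-Between (x ∷ xs) ne (px ∷ pxs) =
  ≤-trans (proj₁ px) (m≤m⊔n x (maxB xs)) , maxB-≤ (x ∷ xs) (proj₂ px ∷ All-map proj₂ pxs)

minB-Between : ∀ {lo hi} B → B ≢ [] → All (Between lo hi) B → Between lo hi (minB B)
minB-Between [] ne _ = ⊥-elim (ne refl)
minB-Between {lo} {hi} (x ∷ xs) _ (px ∷ pxs) = go xs pxs , ≤-trans (le xs) (proj₂ px)
  where
  go : ∀ ys → All (Between lo hi) ys → lo ≤ foldr _⊓_ x ys
  go [] [] = proj₁ px
  go (y ∷ ys) (py ∷ pys) = ⊓-glb (proj₁ py) (go ys pys)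
  le : ∀ ys → foldr _⊓_ x ys ≤ x
  le [] = ≤-refl
  le (y ∷ ys) = ≤-trans (m⊓n≤n y _) (le ys)

maxB-separated : ∀ {lo1 hi1 lo2 hi2 xs ys} → InRange lo1 hi1 xs → NonEmptyAll xs → InRange lo2 hi2 ys → NonEmptyAll ys → hi1 < lo2 →
        All (λ B → All (λ C → maxB B < maxB C) ys) xs
maxB-separated {xs = []} [] [] r2 n2 lt = []
maxB-separated {xs = B ∷ xs} (r ∷ rs) (n ∷ ns) r2 n2 lt = go r2 n2 ∷ maxB-separated rs ns r2 n2 lt
  where
  go : ∀ {ys} → InRange _ _ ys → NonEmptyAll ys → All (λ C → maxB B < maxB C) ys
  go [] [] = []
  go {C ∷ ys} (q ∷ qs) (m ∷ ms) =
    ≤-<-trans (proj₂ (maxB-Between B n r)) (<-≤-trans lt (proj₁ (maxB-Between C m q))) ∷ go qs ms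

sorted-shift : ∀ c {bs} → SortedB bs → NonEmptyAll bs → SortedB (shift c bs)
sorted-shift c [] [] = []
sorted-shift c {B ∷ bs} (a ∷ s) (n ∷ ns) = AllP.map⁺ (go bs a ns) ∷ sorted-shift c s ns
  where
  go : ∀ cs → All (λ C → maxB B < maxB C) cs → NonEmptyAll cs → All (λ C → maxB (map (c +_) B) < maxB (map (c +_) C)) cs
  go [] [] [] = []
  go (C ∷ cs) (l ∷ ls) (m ∷ ms) =
    subst₂ _<_ (sym (maxB-shift c B n)) (sym (maxB-shift c C m)) (+-monoʳ-< c l) ∷ go cs ls ms

unshift : ∀ c bs → map (map (_∸ c)) (shift c bs) ≡ bs
unshift c bs = trans (sym (map-∘ bs)) (trans (map-cong (λ B → trans (sym (map-∘ B)) (trans (map-cong (λ x → m+n∸m≡n c x) B) (map-id B))) bs) (map-id bs))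

unshift0 : ∀ bs → map (map (_∸ 0)) bs ≡ bs
unshift0 bs = trans (map-cong (λ B → map-id B) bs) (map-id bs)

unshiftB : ∀ c B → map (_∸ c) (map (c +_) B) ≡ B
unshiftB c B = trans (sym (map-∘ B)) (trans (map-cong (λ x → m+n∸m≡n c x) B) (map-id B))

shift-unshift : ∀ b bs → All (All (b ≤_)) bs → shift b (map (map (_∸ b)) bs) ≡ bs
shift-unshift b bs h = trans (sym (map-∘ bs)) (map-id-local (All-map (λ {C} hC → trans (sym (map-∘ C)) (map-id-local (All-map (λ le → m+[n∸m]≡n le) hC))) h))

increasing-unshift : ∀ b C → All (b ≤_) C → AllPairs _<_ C → AllPairs _<_ (map (_∸ b) C)
increasing-unshift b [] [] [] = []
increasing-unshift b (x ∷ C) (bx ∷ bC) (a ∷ r) = AllP.map⁺ (All-map (λ lt → ∸-monoˡ-< lt bx) a) ∷ increasing-unshift b C bC r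

sorted-unshift : ∀ b bs → SortedB (shift b bs) → NonEmptyAll bs → SortedB bs
sorted-unshift b [] _ [] = []
sorted-unshift b (B ∷ bs) (a ∷ r) (ne ∷ nes) = go bs (AllP.map⁻ a) nes ∷ sorted-unshift b bs r nes
  where
  go : ∀ cs → All (λ C → maxB (map (b +_) B) < maxB (map (b +_) C)) cs → NonEmptyAll cs → All (λ C → maxB B < maxB C) cs
  go [] [] [] = []
  go (C ∷ cs) (l ∷ ls) (m ∷ ms) = +-cancelˡ-< b _ _ (subst₂ _<_ (maxB-shift b B ne) (maxB-shift b C m) l) ∷ go cs ls ms

Increasing : List Block → Set
Increasing = All (AllPairs _<_)

increasing-shift : ∀ c {bs} → Increasing bs → Increasing (shift c bs)
increasing-shift c [] = []
increasing-shift c (i ∷ is) = APP.map⁺ (AP.map (+-monoʳ-< c) i) ∷ increasing-shift c is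

snoc-view : ∀ {A : Set} (xs : List A) → (xs ≡ []) ⊎ Σ (List A) (λ ys → Σ A (λ y → xs ≡ ys ++ [ y ]))
snoc-view [] = inj₁ refl
snoc-view (x ∷ xs) with snoc-view xs
... | inj₁ refl = inj₂ ([] , x , refl)
... | inj₂ (ys , y , refl) = inj₂ (x ∷ ys , y , refl)

length-snoc≢0 : ∀ (xs : List ℕ) y → length (xs ++ [ y ]) ≢ 0
length-snoc≢0 [] y ()
length-snoc≢0 (x ∷ xs) y ()

AllPairs-prefix : ∀ {A : Set} {R : A → A → Set} xs ys → AllPairs R (xs ++ ys) → AllPairs R xs
AllPairs-prefix [] ys _ = []
AllPairs-prefix (x ∷ xs) ys (a ∷ r) = AllP.++⁻ˡ xs a ∷ AllPairs-prefix xs ys r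

AllPairs-suffix : ∀ {A : Set} {R : A → A → Set} xs ys → AllPairs R (xs ++ ys) → AllPairs R ys
AllPairs-suffix [] ys r = r
AllPairs-suffix (x ∷ xs) ys (a ∷ r) = AllPairs-suffix xs ys r

AllPairs-dropMiddle : ∀ {A : Set} {R : A → A → Set} xs ys zs → AllPairs R (xs ++ (ys ++ zs)) → AllPairs R (xs ++ zs)
AllPairs-dropMiddle [] ys zs r = AllPairs-suffix ys zs r
AllPairs-dropMiddle (x ∷ xs) ys zs (a ∷ r) = AllP.++⁺ (AllP.++⁻ˡ xs a) (AllP.++⁻ʳ ys (AllP.++⁻ʳ xs a)) ∷ AllPairs-dropMiddle xs ys zs r

AllPairs-last : ∀ {A : Set} {R : A → A → Set} xs y → AllPairs R (xs ++ [ y ]) → All (λ x → R x y) xs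
AllPairs-last [] y _ = []
AllPairs-last (x ∷ xs) y (a ∷ r) = All.head (AllP.++⁻ʳ xs a) ∷ AllPairs-last xs y r

last : ℕ → List ℕ → ℕ
last x [] = x
last x (y ∷ ys) = last y ys

last-snoc : ∀ x xs y → last x (xs ++ [ y ]) ≡ y
last-snoc x [] y = refl
last-snoc x (z ∷ zs) y = last-snoc z zs y

last-max : ∀ x xs → AllPairs _<_ (x ∷ xs) → All (_≤ last x xs) (x ∷ xs) × (last x xs ∈ (x ∷ xs))
last-max x [] _ = (≤-refl ∷ []) , here refl
last-max x (y ∷ ys) (a ∷ r) with last-max y ys r
... | al , m = (≤-trans (<⇒≤ (All.head a)) (All.head al) ∷ al) , there m

head-min : ∀ x xs → AllPairs _<_ (x ∷ xs) → All (x ≤_) (x ∷ xs)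
head-min x xs (a ∷ _) = ≤-refl ∷ All-map <⇒≤ a

increasing-snoc : ∀ {n} B → AllPairs _<_ B → n ∈ B → All (_≤ n) B → Σ (List ℕ) (λ B' → B ≡ B' ++ [ n ])
increasing-snoc (x ∷ []) _ (here refl) _ = [] , refl
increasing-snoc (x ∷ y ∷ ys) (a ∷ r) (here refl) (_ ∷ ly ∷ _) = ⊥-elim (<⇒≱ (All.head a) ly)
increasing-snoc (x ∷ xs) (a ∷ r) (there m) (_ ∷ ls) with increasing-snoc xs r m ls
... | B' , refl = x ∷ B' , refl

-- If an increasing block z ∷ zs starts below b, contains some y > b and avoids b,
-- then one of its edges jumps over b.  This is where noncrossing is used in the
-- surjectivity argument.
cross-gap : ∀ {b y} z zs → AllPairs _<_ (z ∷ zs) → z < b → y ∈ zs → b < y → All (_≢ b) zs →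
            Σ (ℕ × ℕ) (λ e → e ∈ consec (z ∷ zs) × (proj₁ e < b) × (b < proj₂ e))
cross-gap {b} z (w ∷ ws) (a ∷ r) zb m by (wb ∷ nbs) with <-cmp w b
... | tri> _ _ bw = (z , w) , here refl , zb , bw
... | tri≈ _ eq _ = ⊥-elim (wb eq)
... | tri< wlt _ _ with m
...   | here refl = ⊥-elim (<-asym wlt by)
...   | there m' with cross-gap w ws r wlt m' by nbs
...     | e , me , p = e , there me , p

split-sorted : ∀ b xs → AllPairs (λ C D → maxB C < maxB D) xs → All (λ C → maxB C ≢ b) xs →
  Σ (List Block) (λ L → Σ (List Block) (λ Q → (xs ≡ L ++ Q) × All (λ C → maxB C < b) L × All (λ C → b < maxB C) Q))
split-sorted b [] [] [] = [] , [] , refl , [] , []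
split-sorted b (x ∷ xs) (a ∷ s) (nb ∷ nbs) with <-cmp (maxB x) b
... | tri< lt _ _ with split-sorted b xs s nbs
...   | L , Q , refl , aL , aQ = x ∷ L , Q , refl , lt ∷ aL , aQ
split-sorted b (x ∷ xs) (a ∷ s) (nb ∷ nbs) | tri≈ _ eq _ = ⊥-elim (nb eq)
split-sorted b (x ∷ xs) (a ∷ s) (nb ∷ nbs) | tri> _ _ gt = [] , x ∷ xs , refl , [] , (gt ∷ All-map (λ lt → <-trans gt lt) a)

Unique-resp-↭ : ∀ {xs ys : List ℕ} → xs ↭ ys → Unique xs → Unique ys
Unique-resp-↭ p = PermS.Unique-resp-↭ (setoid ℕ) (↭⇒↭ₛ p)

Unique-disjoint : ∀ {x : ℕ} xs ys → Unique (xs ++ ys) → x ∈ xs → x ∈ ys → ⊥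
Unique-disjoint (z ∷ xs) ys (a ∷ u) (here refl) my = All.lookup (AllP.++⁻ʳ xs a) my refl
Unique-disjoint (z ∷ xs) ys (a ∷ u) (there mx) my = Unique-disjoint xs ys u mx my

Unique-dropˡ : ∀ (xs ys : List ℕ) → Unique (xs ++ ys) → Unique ys
Unique-dropˡ [] ys u = u
Unique-dropˡ (x ∷ xs) ys (_ ∷ u) = Unique-dropˡ xs ys u

T→≡ : ∀ {b} → T b → b ≡ true
T→≡ {true} _ = refl

¬T→≡ : ∀ {b} → ¬ T b → b ≡ false
¬T→≡ {false} _ = refl
¬T→≡ {true} n = ⊥-elim (n _)

≤ᵇ-true : ∀ {m n} → m ≤ n → (m ≤ᵇ n) ≡ true
≤ᵇ-true le = T→≡ (≤⇒≤ᵇ le)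

≤ᵇ-false : ∀ {m n} → n < m → (m ≤ᵇ n) ≡ false
≤ᵇ-false {m} {n} lt = ¬T→≡ (λ t → <⇒≱ lt (≤ᵇ⇒≤ m n t))

<ᵇ-true : ∀ {m n} → m < n → (m <ᵇ n) ≡ true
<ᵇ-true lt = T→≡ (<⇒<ᵇ lt)

<ᵇ-false : ∀ {m n} → n ≤ m → (m <ᵇ n) ≡ false
<ᵇ-false {m} {n} le = ¬T→≡ (λ t → ≤⇒≯ le (<ᵇ⇒< m n t))

≡ᵇ-true : ∀ {m n} → m ≡ n → (m ≡ᵇ n) ≡ true
≡ᵇ-true {m} {n} e = T→≡ (≡⇒≡ᵇ m n e)

≡ᵇ-false : ∀ {m n} → m ≢ n → (m ≡ᵇ n) ≡ false
≡ᵇ-false {m} {n} ne = ¬T→≡ (λ t → ne (≡ᵇ⇒≡ m n t))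

<ᵇ-shift : ∀ c x y → (c + x <ᵇ c + y) ≡ (x <ᵇ y)
<ᵇ-shift zero x y = refl
<ᵇ-shift (suc c) x y = <ᵇ-shift c x y

∈ᵇ-true : ∀ {x} xs → x ∈ xs → (x ∈ᵇ xs) ≡ true
∈ᵇ-true {x} (y ∷ xs) (here refl) rewrite ≡ᵇ-true {x} {x} refl = refl
∈ᵇ-true {x} (y ∷ xs) (there i) rewrite ∈ᵇ-true xs i = ∨-zeroʳ (x ≡ᵇ y)

∈ᵇ-false : ∀ {x} xs → All (λ y → x ≢ y) xs → (x ∈ᵇ xs) ≡ false
∈ᵇ-false [] [] = refl
∈ᵇ-false {x} (y ∷ xs) (n ∷ ns) rewrite ≡ᵇ-false n | ∈ᵇ-false xs ns = refl

∈ᵇ-sound : ∀ x xs → (x ∈ᵇ xs) ≡ true → x ∈ xs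
∈ᵇ-sound x (y ∷ xs) e with x ≡ᵇ y in eq
... | true = here (≡ᵇ⇒≡ x y (subst T (sym eq) _))
... | false = there (∈ᵇ-sound x xs e)

any-++ : ∀ {A : Set} (f : A → Bool) xs ys → any f (xs ++ ys) ≡ any f xs ∨ any f ys
any-++ f [] ys = refl
any-++ f (x ∷ xs) ys = trans (cong (f x ∨_) (any-++ f xs ys)) (sym (∨-assoc (f x) _ _))

any-map : ∀ {A B : Set} (f : B → Bool) (g : A → B) xs → any f (map g xs) ≡ any (f ∘ g) xs
any-map f g [] = refl
any-map f g (x ∷ xs) = cong (f (g x) ∨_) (any-map f g xs)

any-ext : ∀ {A : Set} {f g : A → Bool} → (∀ x → f x ≡ g x) → ∀ xs → any f xs ≡ any g xs
any-ext e [] = refl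
any-ext e (x ∷ xs) = cong₂ _∨_ (e x) (any-ext e xs)

any-false : ∀ {A : Set} (f : A → Bool) xs → (∀ {x} → x ∈ xs → f x ≡ false) → any f xs ≡ false
any-false f [] h = refl
any-false f (x ∷ xs) h rewrite h (here refl) = any-false f xs (λ m → h (there m))

any-true : ∀ {A : Set} (f : A → Bool) {x} xs → x ∈ xs → f x ≡ true → any f xs ≡ true
any-true f (y ∷ xs) (here refl) e rewrite e = refl
any-true f (y ∷ xs) (there m) e rewrite any-true f xs m e = ∨-zeroʳ (f y)

filterᵇ-++ : ∀ {A : Set} (f : A → Bool) xs ys → filterᵇ f (xs ++ ys) ≡ filterᵇ f xs ++ filterᵇ f ys
filterᵇ-++ f [] ys = refl
filterᵇ-++ f (x ∷ xs) ys with f x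
... | true = cong (x ∷_) (filterᵇ-++ f xs ys)
... | false = filterᵇ-++ f xs ys

filterᵇ-all : ∀ {A : Set} (f : A → Bool) xs → All (λ x → f x ≡ true) xs → filterᵇ f xs ≡ xs
filterᵇ-all f [] [] = refl
filterᵇ-all f (x ∷ xs) (e ∷ es) rewrite e = cong (x ∷_) (filterᵇ-all f xs es)

filterᵇ-none : ∀ {A : Set} (f : A → Bool) xs → All (λ x → f x ≡ false) xs → filterᵇ f xs ≡ []
filterᵇ-none f [] [] = refl
filterᵇ-none f (x ∷ xs) (e ∷ es) rewrite e = filterᵇ-none f xs es

filterᵇ-cong : ∀ {A : Set} {f g : A → Bool} xs → All (λ x → f x ≡ g x) xs → filterᵇ f xs ≡ filterᵇ g xs
filterᵇ-cong [] [] = refl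
filterᵇ-cong {g = g} (x ∷ xs) (e ∷ es) rewrite e with g x
... | true = cong (x ∷_) (filterᵇ-cong xs es)
... | false = filterᵇ-cong xs es

filterᵇ-map : ∀ {A B : Set} (f : B → Bool) (g : A → B) xs → filterᵇ f (map g xs) ≡ map g (filterᵇ (f ∘ g) xs)
filterᵇ-map f g [] = refl
filterᵇ-map f g (x ∷ xs) with f (g x)
... | true = cong (g x ∷_) (filterᵇ-map f g xs)
... | false = filterᵇ-map f g xs

NoncrossingOn : (ℕ × ℕ → Set) → Set
NoncrossingOn S = ∀ {a b c d} → S (a , b) → S (c , d) → ¬ ((a < c) × (c < b) × (b < d))

EdgeOf : List Block → ℕ × ℕ → Set
EdgeOf bs e = e ∈ edges bs

edges-eq : ∀ xs ys → edges (xs ++ ys) ≡ edges xs ++ edges ys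
edges-eq xs ys = concatMap-++ consec xs ys

edges-++ : ∀ {e} xs ys → e ∈ edges (xs ++ ys) → e ∈ edges xs ⊎ e ∈ edges ys
edges-++ xs ys m = ∈-++⁻ (edges xs) (subst (_ ∈_) (concatMap-++ consec xs ys) m)

edges-++ˡ : ∀ {e} xs ys → e ∈ edges xs → e ∈ edges (xs ++ ys)
edges-++ˡ xs ys m = subst (_ ∈_) (sym (concatMap-++ consec xs ys)) (∈-++⁺ˡ m)

edges-++ʳ : ∀ {e} xs ys → e ∈ edges ys → e ∈ edges (xs ++ ys)
edges-++ʳ xs ys m = subst (_ ∈_) (sym (concatMap-++ consec xs ys)) (∈-++⁺ʳ (edges xs) m)

edge-of : ∀ {e C} bs → C ∈ bs → e ∈ consec C → e ∈ edges bs
edge-of (C ∷ bs) (here refl) m = ∈-++⁺ˡ m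
edge-of (D ∷ bs) (there mC) m = ∈-++⁺ʳ (consec D) (edge-of bs mC m)

shiftEdge : ℕ → ℕ × ℕ → ℕ × ℕ
shiftEdge c (x , y) = c + x , c + y

consec-map : ∀ c B → consec (map (c +_) B) ≡ map (shiftEdge c) (consec B)
consec-map c [] = refl
consec-map c (x ∷ []) = refl
consec-map c (x ∷ y ∷ B) = cong ((c + x , c + y) ∷_) (consec-map c (y ∷ B))

edges-shift : ∀ c bs → edges (shift c bs) ≡ map (shiftEdge c) (edges bs)
edges-shift c [] = refl
edges-shift c (B ∷ bs) = trans (cong₂ _++_ (consec-map c B) (edges-shift c bs)) (sym (map-++ (shiftEdge c) (consec B) (edges bs)))

consec-range : ∀ {Q : ℕ → Set} {e} B → All Q B → e ∈ consec B → Q (proj₁ e) × Q (proj₂ e)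
consec-range (x ∷ y ∷ B) (px ∷ py ∷ pB) (here refl) = px , py
consec-range (x ∷ y ∷ B) (px ∷ pB) (there m) = consec-range (y ∷ B) pB m

edges-range : ∀ {Q : ℕ → Set} {e} bs → All (All Q) bs → e ∈ edges bs → Q (proj₁ e) × Q (proj₂ e)
edges-range (B ∷ bs) (pB ∷ pbs) m with ∈-++⁻ (consec B) m
... | inj₁ m' = consec-range B pB m'
... | inj₂ m' = edges-range bs pbs m'

consec-snoc : ∀ {e} x xs y → e ∈ consec ((x ∷ xs) ++ [ y ]) → e ∈ consec (x ∷ xs) ⊎ e ≡ (last x xs , y)
consec-snoc x [] y (here refl) = inj₂ refl
consec-snoc x (z ∷ zs) y (here refl) = inj₁ (here refl)
consec-snoc x (z ∷ zs) y (there m) with consec-snoc z zs y m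
... | inj₁ m' = inj₁ (there m')
... | inj₂ eq = inj₂ eq

consec-sub : ∀ {e} x xs y → e ∈ consec (x ∷ xs) → e ∈ consec ((x ∷ xs) ++ [ y ])
consec-sub x (z ∷ zs) y (here refl) = here refl
consec-sub x (z ∷ zs) y (there m) = there (consec-sub z zs y m)

consec-last : ∀ x xs y → (last x xs , y) ∈ consec ((x ∷ xs) ++ [ y ])
consec-last x [] y = here refl
consec-last x (z ∷ zs) y = there (consec-last z zs y)

NC-subset : ∀ {S S' : ℕ × ℕ → Set} → (∀ {e} → S' e → S e) → NoncrossingOn S → NoncrossingOn S'
NC-subset f nc s1 s2 = nc (f s1) (f s2)

NC-separated : ∀ {S1 S2 : ℕ × ℕ → Set} h → NoncrossingOn S1 → NoncrossingOn S2 → (∀ {e} → S1 e → (proj₁ e ≤ h) × (proj₂ e ≤ h)) →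
         (∀ {e} → S2 e → h < proj₁ e) → NoncrossingOn (λ e → S1 e ⊎ S2 e)
NC-separated h n1 n2 r1 r2 (inj₁ x) (inj₁ y) = n1 x y
NC-separated h n1 n2 r1 r2 (inj₂ x) (inj₂ y) = n2 x y
NC-separated h n1 n2 r1 r2 (inj₁ x) (inj₂ y) (_ , cb , _) = <-asym (<-≤-trans cb (proj₂ (r1 x))) (r2 y)
NC-separated h n1 n2 r1 r2 (inj₂ x) (inj₁ y) (ac , _ , _) = <-asym (<-≤-trans ac (proj₁ (r1 y))) (r2 x)

NC-insert : ∀ {S : ℕ × ℕ → Set} e0 → NoncrossingOn S →
         (∀ {a b} → S (a , b) → ¬ ((a < proj₁ e0) × (proj₁ e0 < b) × (b < proj₂ e0))) →
         (∀ {a b} → S (a , b) → ¬ ((proj₁ e0 < a) × (a < proj₂ e0) × (proj₂ e0 < b))) →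
         NoncrossingOn (λ e → S e ⊎ e ≡ e0)
NC-insert e0 nc f g (inj₁ x) (inj₁ y) = nc x y
NC-insert e0 nc f g (inj₁ x) (inj₂ refl) = f x
NC-insert e0 nc f g (inj₂ refl) (inj₁ y) = g y
NC-insert e0 nc f g (inj₂ refl) (inj₂ refl) (ac , _ , _) = <-irrefl refl ac

NC-shift : ∀ c bs → NoncrossingOn (EdgeOf bs) → NoncrossingOn (EdgeOf (shift c bs))
NC-shift c bs nc m1 m2 (ac , cb , bd) with ∈-map⁻ (shiftEdge c) (subst (_ ∈_) (edges-shift c bs) m1) | ∈-map⁻ (shiftEdge c) (subst (_ ∈_) (edges-shift c bs) m2)
... | (a' , b') , m1' , refl | (c' , d') , m2' , refl =
  nc m1' m2' (+-cancelˡ-< c a' c' ac , +-cancelˡ-< c c' b' cb , +-cancelˡ-< c b' d' bd)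

insertB-front : ∀ B cs → All (λ C → maxB B < maxB C) cs → insertB B cs ≡ B ∷ cs
insertB-front B [] _ = refl
insertB-front B (C ∷ cs) (l ∷ _) rewrite ≤ᵇ-true (<⇒≤ l) = refl

insertB-last : ∀ B cs → All (λ C → maxB C < maxB B) cs → insertB B cs ≡ cs ++ [ B ]
insertB-last B [] _ = refl
insertB-last B (C ∷ cs) (l ∷ ls) rewrite ≤ᵇ-false l = cong (C ∷_) (insertB-last B cs ls)

insertAll-sorted : ∀ xs ys → SortedB (xs ++ ys) → foldr insertB ys xs ≡ xs ++ ys
insertAll-sorted [] ys _ = refl
insertAll-sorted (x ∷ xs) ys (a ∷ s) rewrite insertAll-sorted xs ys s = insertB-front x (xs ++ ys) a

canon-sorted : ∀ xs → SortedB xs → canon xs ≡ xs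
canon-sorted xs s = trans (insertAll-sorted xs [] (subst SortedB (sym (++-identityʳ xs)) s)) (++-identityʳ xs)

canon-move-last : ∀ xs o ys → SortedB ((xs ++ ys) ++ [ o ]) → canon (xs ++ (o ∷ ys)) ≡ (xs ++ ys) ++ [ o ]
canon-move-last xs o ys s = begin
    canon (xs ++ (o ∷ ys))                    ≡⟨ foldr-++ insertB [] xs (o ∷ ys) ⟩
    foldr insertB (insertB o (canon ys)) xs   ≡⟨ cong (λ u → foldr insertB (insertB o u) xs) (canon-sorted ys sorted-ys) ⟩
    foldr insertB (insertB o ys) xs           ≡⟨ cong (λ u → foldr insertB u xs) (insertB-last o ys (AllPairs-last ys o sorted-ys-o)) ⟩
    foldr insertB (ys ++ [ o ]) xs            ≡⟨ insertAll-sorted xs (ys ++ [ o ]) s' ⟩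
    xs ++ (ys ++ [ o ])                       ≡⟨ sym (++-assoc xs ys [ o ]) ⟩
    (xs ++ ys) ++ [ o ]                       ∎
  where
  open ≡-Reasoning
  s' : SortedB (xs ++ (ys ++ [ o ]))
  s' = subst SortedB (++-assoc xs ys [ o ]) s
  sorted-ys-o : SortedB (ys ++ [ o ])
  sorted-ys-o = AllPairs-suffix xs (ys ++ [ o ]) s'
  sorted-ys : SortedB ys
  sorted-ys = AllPairs-prefix ys [ o ] sorted-ys-o

Outside : ℕ → ℕ → ℕ → Set
Outside l r x = (x < l) ⊎ (r < x)

restrictBlock : ℕ → ℕ → Block → Block
restrictBlock l r B = map (_∸ (l ∸ 1)) (filterᵇ (λ x → (l ≤ᵇ x) ∧ (x ≤ᵇ r)) B)

restrictAll : ℕ → ℕ → List Block → List Block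
restrictAll l r bs = filterᵇ (λ B → not (null B)) (map (restrictBlock l r) bs)

restrictAll-++ : ∀ l r xs ys → restrictAll l r (xs ++ ys) ≡ restrictAll l r xs ++ restrictAll l r ys
restrictAll-++ l r xs ys = trans (cong (filterᵇ _) (map-++ (restrictBlock l r) xs ys)) (filterᵇ-++ _ (map (restrictBlock l r) xs) _)

restrictBlock-++ : ∀ l r xs ys → restrictBlock l r (xs ++ ys) ≡ restrictBlock l r xs ++ restrictBlock l r ys
restrictBlock-++ l r xs ys = trans (cong (map _) (filterᵇ-++ _ xs ys)) (map-++ (_∸ (l ∸ 1)) (filterᵇ (λ x → (l ≤ᵇ x) ∧ (x ≤ᵇ r)) xs) _)

restrictBlock-out : ∀ l r B → All (Outside l r) B → restrictBlock l r B ≡ []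
restrictBlock-out l r B o = cong (map _) (filterᵇ-none _ B (All-map f o))
  where
  f : ∀ {x} → Outside l r x → ((l ≤ᵇ x) ∧ (x ≤ᵇ r)) ≡ false
  f {x} (inj₁ lt) rewrite ≤ᵇ-false lt = refl
  f {x} (inj₂ lt) rewrite ≤ᵇ-false lt = ∧-zeroʳ (l ≤ᵇ x)

restrictBlock-in : ∀ c r B → All (Between (suc c) r) B → restrictBlock (suc c) r B ≡ map (_∸ c) B
restrictBlock-in c r B i = cong (map _) (filterᵇ-all _ B (All-map f i))
  where
  f : ∀ {x} → Between (suc c) r x → ((suc c ≤ᵇ x) ∧ (x ≤ᵇ r)) ≡ true
  f (a , b) rewrite ≤ᵇ-true a | ≤ᵇ-true b = refl

restrictAll-out : ∀ l r bs → All (All (Outside l r)) bs → restrictAll l r bs ≡ []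
restrictAll-out l r [] [] = refl
restrictAll-out l r (B ∷ bs) (o ∷ os) rewrite restrictBlock-out l r B o = restrictAll-out l r bs os

restrictAll-in : ∀ c r bs → InRange (suc c) r bs → NonEmptyAll bs → restrictAll (suc c) r bs ≡ map (map (_∸ c)) bs
restrictAll-in c r [] [] [] = refl
restrictAll-in c r (B ∷ bs) (i ∷ is) (n ∷ ns) rewrite restrictBlock-in c r B i with B
... | [] = ⊥-elim (n refl)
... | x ∷ B' = cong (map (_∸ c) (x ∷ B') ∷_) (restrictAll-in c r bs is ns)

restrictAll-single : ∀ l r B x xs → restrictBlock l r B ≡ x ∷ xs → restrictAll l r [ B ] ≡ [ x ∷ xs ]
restrictAll-single l r B x xs e rewrite e = refl

InRange-below : ∀ {lo hi l r bs} → InRange lo hi bs → hi < l → All (All (Outside l r)) bs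
InRange-below rs lt = All-map (All-map (λ i → inj₁ (≤-<-trans (proj₂ i) lt))) rs

InRange-above : ∀ {lo hi l r bs} → InRange lo hi bs → r < lo → All (All (Outside l r)) bs
InRange-above rs lt = All-map (All-map (λ i → inj₂ (<-≤-trans lt (proj₁ i)))) rs

findBlock-skip : ∀ x xs ys → All (λ B → (x ∈ᵇ B) ≡ false) xs → findBlock x (xs ++ ys) ≡ findBlock x ys
findBlock-skip x [] ys [] = refl
findBlock-skip x (B ∷ xs) ys (e ∷ es) rewrite e = findBlock-skip x xs ys es

findBlock-here : ∀ x B ys → (x ∈ᵇ B) ≡ true → findBlock x (B ∷ ys) ≡ just B
findBlock-here x B ys e rewrite e = refl

∉-InRange : ∀ {lo hi x} bs → InRange lo hi bs → hi < x → All (λ B → (x ∈ᵇ B) ≡ false) bs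
∉-InRange [] [] lt = []
∉-InRange (B ∷ bs) (r ∷ rs) lt = ∈ᵇ-false B (All-map (λ i eq → <⇒≢ (≤-<-trans (proj₂ i) lt) (sym eq)) r) ∷ ∉-InRange bs rs lt

findBlock-unique : ∀ {x B} bs → Unique (concat bs) → x ∈ B → B ∈ bs → findBlock x bs ≡ just B
findBlock-unique {x} (C ∷ bs) u mx (here refl) rewrite ∈ᵇ-true C mx = refl
findBlock-unique {x} (C ∷ bs) u mx (there mB) with x ∈ᵇ C in eq
... | true = ⊥-elim (Unique-disjoint C (concat bs) u (∈ᵇ-sound x C eq) (∈-concat⁺′ mx mB))
... | false = findBlock-unique bs (Unique-dropˡ C (concat bs) u) mx mB

singletonBlock-eq : ∀ {x bs B} → findBlock x bs ≡ just B → singletonBlock x bs ≡ (length B ≡ᵇ 1)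
singletonBlock-eq e rewrite e = refl

decomp₁-gen : ∀ {n bs B} → findBlock n bs ≡ just B → (length B ≡ᵇ 1) ≡ false → decomp₁ (n , bs) ≡ decompGen (n , bs) B
decomp₁-gen e e2 rewrite e | e2 = refl

decomp₂-gen : ∀ {n bs B} → findBlock n bs ≡ just B → (length B ≡ᵇ 1) ≡ false → decomp₂ (n , bs) ≡ decompGen (n , bs) B
decomp₂-gen e e2 rewrite e | e2 = refl

decomp₁-single : ∀ {n bs B} → findBlock n bs ≡ just B → (length B ≡ᵇ 1) ≡ true → decomp₁ (n , bs) ≡ (restrict (n , bs) 1 (n ∸ 1) , ∅ₚ , ∅ₚ)
decomp₁-single e e2 rewrite e | e2 = refl

decomp₂-single : ∀ {n bs B} → findBlock n bs ≡ just B → (length B ≡ᵇ 1) ≡ true → decomp₂ (n , bs) ≡ (∅ₚ , ∅ₚ , restrict (n , bs) 1 (n ∸ 1))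
decomp₂-single e e2 rewrite e | e2 = refl

lastNonSingleton-step : ∀ k bs → singletonBlock (suc k) bs ≡ true → lastNonSingleton (suc k) bs ≡ lastNonSingleton k bs
lastNonSingleton-step k bs e rewrite e = refl

lastNonSingleton-stop : ∀ k bs → singletonBlock (suc k) bs ≡ false → lastNonSingleton (suc k) bs ≡ just (suc k)
lastNonSingleton-stop k bs e rewrite e = refl

ξₚ-nothing : ∀ n bs → lastNonSingleton n bs ≡ nothing → ξₚ (n , bs) ≡ (n , bs)
ξₚ-nothing n bs e rewrite e = refl

ξₚ-just : ∀ n bs k → lastNonSingleton n bs ≡ just k →
  ξₚ (n , bs) ≡ ξcore (restrict (n , bs) 1 k) ⊎ₚ ((n ∸ k) , map (λ i → suc i ∷ []) (upTo (n ∸ k)))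
ξₚ-just n bs k e rewrite e = refl

-- The syntax of noncrossing partitions.

-- A Term is a list of connected components,
-- read left to right (π = κ₁ ⊎ ⋯ ⊎ κₖ).  A Conn is a connected partition: either
-- the one-point partition `unit` = {1}, or `ext K q` = K * q for K connected,
-- which places q after K and adds a new last point to the block containing 1
-- (the outer block).
mutual
  data Term : Set where
    ε : Term
    _▷_ : Term → Conn → Term
  data Conn : Set where
    unit : Conn
    ext : Conn → Term → Conn

mutual
  size : Term → ℕ
  size ε = 0
  size (p ▷ K) = size p + sizeC K
  sizeC : Conn → ℕ
  sizeC K = suc (sizeC⁻ K)
  sizeC⁻ : Conn → ℕ
  sizeC⁻ unit = 0
  sizeC⁻ (ext K q) = sizeC⁻ K + size q + 1

otail : Conn → List ℕ
otail unit = []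
otail (ext K q) = otail K ++ [ sizeC (ext K q) ]

outer : Conn → Block
outer K = 1 ∷ otail K

-- Denotation: the canonical list of blocks of a term.  denC K lists the inner blocks
-- (those of the nested terms q) followed by the outer block, which has the largest
-- maximum.
mutual
  den : Term → List Block
  den ε = []
  den (p ▷ K) = den p ++ shift (size p) (denC K)
  denC : Conn → List Block
  denC K = inner K ++ [ outer K ]
  inner : Conn → List Block
  inner unit = []
  inner (ext K q) = inner K ++ shift (sizeC K) (den q)

⟦_⟧ : Term → Part
⟦ p ⟧ = size p , den p

_++P_ : Term → Term → Term
p ++P ε = p
p ++P (q ▷ K) = (p ++P q) ▷ K

size-++ : ∀ p q → size (p ++P q) ≡ size p + size q
size-++ p ε = sym (+-identityʳ (size p))
size-++ p (q ▷ K) = trans (cong (_+ sizeC K) (size-++ p q)) (+-assoc (size p) (size q) (sizeC K))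

den-++ : ∀ p q → den (p ++P q) ≡ den p ++ shift (size p) (den q)
den-++ p ε = sym (++-identityʳ (den p))
den-++ p (q ▷ K) = begin
    den (p ++P q) ++ shift (size (p ++P q)) (denC K)
  ≡⟨ cong₂ (λ u v → u ++ shift v (denC K)) (den-++ p q) (size-++ p q) ⟩
    (den p ++ shift (size p) (den q)) ++ shift (size p + size q) (denC K)
  ≡⟨ ++-assoc (den p) _ _ ⟩
    den p ++ (shift (size p) (den q) ++ shift (size p + size q) (denC K))
  ≡⟨ cong (λ u → den p ++ (shift (size p) (den q) ++ u)) (sym (shift-shift (size p) (size q) (denC K))) ⟩
    den p ++ (shift (size p) (den q) ++ shift (size p) (shift (size q) (denC K)))
  ≡⟨ cong (den p ++_) (sym (shift-++ (size p) (den q) _)) ⟩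
    den p ++ shift (size p) (den q ++ shift (size q) (denC K)) ∎
  where open ≡-Reasoning

++P-identityˡ : ∀ p → ε ++P p ≡ p
++P-identityˡ ε = refl
++P-identityˡ (p ▷ K) = cong (_▷ K) (++P-identityˡ p)

++P-assoc : ∀ p q r → (p ++P q) ++P r ≡ p ++P (q ++P r)
++P-assoc p q ε = refl
++P-assoc p q (r ▷ K) = cong (_▷ K) (++P-assoc p q r)

sizeC-ext : ∀ K q → sizeC K + size q ≡ sizeC⁻ (ext K q)
sizeC-ext K q = sym (+-comm (sizeC⁻ K + size q) 1)

⟦_⟧M : Maybe Conn → Part
⟦ nothing ⟧M = ∅ₚ
⟦ just K ⟧M = sizeC K , denC K

star : Maybe Conn → Term → Term
star nothing q = q ▷ unit
star (just K) q = ε ▷ ext K q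

unitsP : ℕ → Term
unitsP zero = ε
unitsP (suc m) = unitsP m ▷ unit

size-units : ∀ m → size (unitsP m) ≡ m
size-units zero = refl
size-units (suc m) = trans (cong (_+ 1) (size-units m)) (+-comm m 1)

-- Every term denotes a noncrossing partition.

otail-range : ∀ K → All (Between 2 (sizeC K)) (otail K)
otail-range unit = []
otail-range (ext K q) = AllP.++⁺ (All-map (Between-weaken ≤-refl le) (otail-range K)) ((s≤s (m≤n+m 1 _) , ≤-refl) ∷ [])
  where le : sizeC K ≤ sizeC (ext K q)
        le = s≤s (≤-trans (m≤m+n (sizeC⁻ K) (size q)) (m≤m+n _ 1))

outer-range : ∀ K → All (Between 1 (sizeC K)) (outer K)
outer-range K = (≤-refl , s≤s z≤n) ∷ All-map (Between-weaken (s≤s z≤n) ≤-refl) (otail-range K)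

sizeC∈outer : ∀ K → sizeC K ∈ outer K
sizeC∈outer unit = here refl
sizeC∈outer (ext K q) = there (∈-++⁺ʳ (otail K) (here refl))

maxB-outer : ∀ K → maxB (outer K) ≡ sizeC K
maxB-outer K = maxB-eq (outer K) (All-map proj₂ (outer-range K)) (sizeC∈outer K)

mutual
  den-range : ∀ p → InRange 1 (size p) (den p)
  den-range ε = []
  den-range (p ▷ K) = AllP.++⁺ (InRange-weaken ≤-refl (m≤m+n (size p) (sizeC K)) (den-range p))
                             (InRange-weaken (m≤n+m 1 _) ≤-refl (InRange-shift (size p) (denC-range K)))
  denC-range : ∀ K → InRange 1 (sizeC K) (denC K)
  denC-range K = AllP.++⁺ (InRange-weaken ≤-refl (n≤1+n _) (inner-range K)) (outer-range K ∷ [])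
  inner-range : ∀ K → InRange 1 (sizeC⁻ K) (inner K)
  inner-range unit = []
  inner-range (ext K q) = AllP.++⁺
     (InRange-weaken ≤-refl (≤-trans (m≤m+n (sizeC⁻ K) (size q)) (m≤m+n (sizeC⁻ K + size q) 1)) (inner-range K))
     (InRange-weaken (m≤n+m 1 (sizeC K)) (≤-reflexive (sizeC-ext K q)) (InRange-shift (sizeC K) (den-range q)))

mutual
  den-nonempty : ∀ p → NonEmptyAll (den p)
  den-nonempty ε = []
  den-nonempty (p ▷ K) = AllP.++⁺ (den-nonempty p) (NonEmptyAll-shift (size p) (denC-nonempty K))
  denC-nonempty : ∀ K → NonEmptyAll (denC K)
  denC-nonempty K = AllP.++⁺ (inner-nonempty K) ((λ ()) ∷ [])
  inner-nonempty : ∀ K → NonEmptyAll (inner K)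
  inner-nonempty unit = []
  inner-nonempty (ext K q) = AllP.++⁺ (inner-nonempty K) (NonEmptyAll-shift (sizeC K) (den-nonempty q))

mutual
  den-sorted : ∀ p → SortedB (den p)
  den-sorted ε = []
  den-sorted (p ▷ K) = APP.++⁺ (den-sorted p) (sorted-shift (size p) (denC-sorted K) (denC-nonempty K))
     (maxB-separated (den-range p) (den-nonempty p) (InRange-shift (size p) (denC-range K)) (NonEmptyAll-shift (size p) (denC-nonempty K))
            (≤-reflexive (sym (+-comm (size p) 1))))
  denC-sorted : ∀ K → SortedB (denC K)
  denC-sorted K = APP.++⁺ (inner-sorted K) ([] ∷ []) (go (inner K) (inner-range K) (inner-nonempty K))
    where
    go : ∀ bs → InRange 1 (sizeC⁻ K) bs → NonEmptyAll bs → All (λ B → All (λ C → maxB B < maxB C) [ outer K ]) bs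
    go [] [] [] = []
    go (B ∷ bs) (r ∷ rs) (n ∷ ns) =
      (subst (maxB B <_) (sym (maxB-outer K)) (s≤s (proj₂ (maxB-Between B n r))) ∷ []) ∷ go bs rs ns
  inner-sorted : ∀ K → SortedB (inner K)
  inner-sorted unit = []
  inner-sorted (ext K q) = APP.++⁺ (inner-sorted K) (sorted-shift (sizeC K) (den-sorted q) (den-nonempty q))
     (maxB-separated (inner-range K) (inner-nonempty K) (InRange-shift (sizeC K) (den-range q)) (NonEmptyAll-shift (sizeC K) (den-nonempty q))
            (<-≤-trans (n<1+n (sizeC⁻ K)) (m≤m+n (sizeC K) 1)))

interval : ℕ → List ℕ
interval n = applyUpTo suc n

interval-suc : ∀ n → interval (suc n) ≡ interval n ++ [ suc n ]
interval-suc n = sym (applyUpTo-∷ʳ suc n)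

interval-split : ∀ a b → interval (a + b) ≡ interval a ++ map (a +_) (interval b)
interval-split a zero = trans (cong interval (+-identityʳ a)) (sym (++-identityʳ (interval a)))
interval-split a (suc b) = begin
    interval (a + suc b)                         ≡⟨ cong interval (+-suc a b) ⟩
    interval (suc (a + b))                       ≡⟨ interval-suc (a + b) ⟩
    interval (a + b) ++ [ suc (a + b) ]          ≡⟨ cong₂ (λ u v → u ++ [ v ]) (interval-split a b) (sym (+-suc a b)) ⟩
    (interval a ++ map (a +_) (interval b)) ++ [ a + suc b ]   ≡⟨ ++-assoc (interval a) _ _ ⟩
    interval a ++ (map (a +_) (interval b) ++ [ a + suc b ])   ≡⟨ cong (interval a ++_) (sym (map-++ (a +_) (interval b) [ suc b ])) ⟩
    interval a ++ map (a +_) (interval b ++ [ suc b ])          ≡⟨ cong (λ u → interval a ++ map (a +_) u) (sym (interval-suc b)) ⟩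
    interval a ++ map (a +_) (interval (suc b)) ∎
  where open ≡-Reasoning

mutual
  den-perm : ∀ p → concat (den p) ↭ interval (size p)
  den-perm ε = ↭-refl
  den-perm (p ▷ K) = ↭-trans (↭-reflexive (sym (concat-++ (den p) _)))
     (↭-trans (++⁺ (den-perm p) (↭-trans (↭-reflexive (concat-map (denC K))) (PermP.map⁺ _ (denC-perm K))))
              (↭-reflexive (sym (interval-split (size p) (sizeC K)))))
  denC-perm : ∀ K → concat (denC K) ↭ interval (sizeC K)
  denC-perm unit = ↭-refl
  denC-perm (ext K q) = ↭-trans (↭-reflexive e1) (↭-trans pm (↭-reflexive e2))
    where
    sK = sizeC K
    A = concat (inner K)
    Q = map (sK +_) (concat (den q))
    O = outer K
    n = sizeC (ext K q)
    e1 : concat (denC (ext K q)) ≡ (A ++ Q) ++ (O ++ [ n ])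
    e1 = begin
        concat ((inner K ++ shift sK (den q)) ++ [ O ++ [ n ] ])
      ≡⟨ sym (concat-++ (inner K ++ shift sK (den q)) _) ⟩
        concat (inner K ++ shift sK (den q)) ++ ((O ++ [ n ]) ++ [])
      ≡⟨ cong₂ _++_ (trans (sym (concat-++ (inner K) _)) (cong (A ++_) (concat-map (den q)))) (++-identityʳ _) ⟩
        (A ++ Q) ++ (O ++ [ n ]) ∎
      where open ≡-Reasoning
    ih : A ++ O ↭ interval sK
    ih = ↭-trans (↭-reflexive (trans (cong (A ++_) (sym (++-identityʳ O))) (concat-++ (inner K) [ O ]))) (denC-perm K)
    pm : (A ++ Q) ++ (O ++ [ n ]) ↭ (interval sK ++ map (sK +_) (interval (size q))) ++ [ n ]
    pm = ↭-trans (↭-reflexive (++-assoc A Q (O ++ [ n ])))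
         (↭-trans (++⁺ˡ A (↭-trans (↭-reflexive (sym (++-assoc Q O [ n ]))) (++⁺ʳ [ n ] (++-comm Q O))))
         (↭-trans (↭-reflexive (trans (cong (A ++_) (++-assoc O Q [ n ])) (sym (++-assoc A O (Q ++ [ n ])))))
         (↭-trans (++⁺ʳ (Q ++ [ n ]) ih)
         (↭-trans (↭-reflexive (sym (++-assoc (interval sK) Q [ n ])))
                  (++⁺ʳ [ n ] (++⁺ˡ (interval sK) (PermP.map⁺ _ (den-perm q))))))))
    e2 : (interval sK ++ map (sK +_) (interval (size q))) ++ [ n ] ≡ interval n
    e2 = begin
        (interval sK ++ map (sK +_) (interval (size q))) ++ [ n ]
      ≡⟨ cong (_++ [ n ]) (sym (interval-split sK (size q))) ⟩
        interval (sK + size q) ++ [ n ]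
      ≡⟨ cong (λ u → interval u ++ [ n ]) (sizeC-ext K q) ⟩
        interval (sizeC⁻ (ext K q)) ++ [ n ]
      ≡⟨ sym (interval-suc (sizeC⁻ (ext K q))) ⟩
        interval n ∎
      where open ≡-Reasoning

interval-unique : ∀ n → Unique (interval n)
interval-unique n = UP.applyUpTo⁺₁ suc n (λ i<j _ → <⇒≢ (s≤s i<j))

∈-interval : ∀ n i → (i ∈ interval n) ⇔ ((1 ≤ i) × (i ≤ n))
∈-interval n i = mk⇔ (to n) (from n)
  where
  to : ∀ n → i ∈ interval n → (1 ≤ i) × (i ≤ n)
  to zero ()
  to (suc n) m with ∈-++⁻ (interval n) (subst (i ∈_) (interval-suc n) m)
  ... | inj₁ m' = proj₁ (to n m') , m≤n⇒m≤1+n (proj₂ (to n m'))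
  ... | inj₂ (here refl) = s≤s z≤n , ≤-refl
  from : ∀ n → (1 ≤ i) × (i ≤ n) → i ∈ interval n
  from zero (a , b) = ⊥-elim (<⇒≱ a b)
  from (suc n) (a , b) with m≤n⇒m<n∨m≡n b
  ... | inj₁ lt = subst (i ∈_) (sym (interval-suc n)) (∈-++⁺ˡ (from n (a , ≤-pred lt)))
  ... | inj₂ refl = subst (i ∈_) (sym (interval-suc n)) (∈-++⁺ʳ (interval n) (here refl))

den-unique : ∀ p → Unique (concat (den p))
den-unique p = Unique-resp-↭ (↭-sym (den-perm p)) (interval-unique (size p))

den-covers : ∀ p i → (i ∈ concat (den p)) ⇔ ((1 ≤ i) × (i ≤ size p))
den-covers p i = mk⇔ (λ m → Equivalence.to (∈-interval (size p) i) (∈-resp-↭ (den-perm p) m))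
                     (λ h → ∈-resp-↭ (↭-sym (den-perm p)) (Equivalence.from (∈-interval (size p) i) h))

otail-increasing : ∀ K → AllPairs _<_ (otail K)
otail-increasing unit = []
otail-increasing (ext K q) = APP.++⁺ (otail-increasing K) ([] ∷ []) (All-map (λ i → s≤s (≤-trans (proj₂ i) (≤-trans (m≤m+n (sizeC K) (size q)) (≤-reflexive (sizeC-ext K q)))) ∷ []) (otail-range K))

outer-increasing : ∀ K → AllPairs _<_ (outer K)
outer-increasing K = All-map proj₁ (otail-range K) ∷ otail-increasing K

mutual
  den-increasing : ∀ p → Increasing (den p)
  den-increasing ε = []
  den-increasing (p ▷ K) = AllP.++⁺ (den-increasing p) (increasing-shift (size p) (denC-increasing K))
  denC-increasing : ∀ K → Increasing (denC K)
  denC-increasing K = AllP.++⁺ (inner-increasing K) (outer-increasing K ∷ [])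
  inner-increasing : ∀ K → Increasing (inner K)
  inner-increasing unit = []
  inner-increasing (ext K q) = AllP.++⁺ (inner-increasing K) (increasing-shift (sizeC K) (den-increasing q))

last-outer : ∀ K → last 1 (otail K) ≡ sizeC K
last-outer unit = refl
last-outer (ext K q) = last-snoc 1 (otail K) _

-- den p is noncrossing: the only new edge of ext K q is (sizeC K , sizeC (ext K q)),
-- and it lies strictly around the shifted edges of q and after those of K.
mutual
  den-NC : ∀ p → NoncrossingOn (EdgeOf (den p))
  den-NC ε ()
  den-NC (p ▷ K) = NC-subset (edges-++ (den p) _)
      (NC-separated (size p) (den-NC p) (NC-shift (size p) (denC K) (denC-NC K))
        (λ m → let r = edges-range (den p) (den-range p) m in proj₂ (proj₁ r) , proj₂ (proj₂ r))
        (λ {e} m → subst (_≤ proj₁ e) (+-comm (size p) 1) (proj₁ (proj₁ (edges-range _ (InRange-shift (size p) (denC-range K)) m)))))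
  denC-NC : ∀ K → NoncrossingOn (EdgeOf (denC K))
  denC-NC unit ()
  denC-NC (ext K q) = NC-subset classify
      (NC-insert (sK , n) (NC-separated sK (denC-NC K) (NC-shift sK (den q) (den-NC q)) r1 r2) f g)
    where
    sK = sizeC K
    n = sizeC (ext K q)
    b' = size q
    r1 : ∀ {e} → EdgeOf (denC K) e → (proj₁ e ≤ sK) × (proj₂ e ≤ sK)
    r1 m = let r = edges-range (denC K) (denC-range K) m in proj₂ (proj₁ r) , proj₂ (proj₂ r)
    rq : ∀ {e} → EdgeOf (shift sK (den q)) e → Between (sK + 1) (sK + b') (proj₁ e) × Between (sK + 1) (sK + b') (proj₂ e)
    rq m = edges-range _ (InRange-shift sK (den-range q)) m
    r2 : ∀ {e} → EdgeOf (shift sK (den q)) e → sK < proj₁ e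
    r2 {e} m = subst (_≤ proj₁ e) (+-comm sK 1) (proj₁ (proj₁ (rq m)))
    qn : sK + b' < n
    qn = s≤s (≤-reflexive (sym (+-comm (sizeC⁻ K + b') 1)))
    f : ∀ {a b} → (EdgeOf (denC K) (a , b) ⊎ EdgeOf (shift sK (den q)) (a , b)) → ¬ ((a < sK) × (sK < b) × (b < n))
    f (inj₁ x) (_ , sb , _) = <⇒≱ sb (proj₂ (r1 x))
    f (inj₂ x) (as , _ , _) = <-asym as (r2 x)
    g : ∀ {a b} → (EdgeOf (denC K) (a , b) ⊎ EdgeOf (shift sK (den q)) (a , b)) → ¬ ((sK < a) × (a < n) × (n < b))
    g (inj₁ x) (_ , _ , nb) = <⇒≱ nb (≤-trans (proj₂ (r1 x)) (≤-trans (m≤m+n sK b') (<⇒≤ qn)))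
    g (inj₂ x) (_ , _ , nb) = <⇒≱ nb (≤-trans (proj₂ (proj₂ (rq x))) (<⇒≤ qn))
    classify : ∀ {e} → EdgeOf (denC (ext K q)) e → (EdgeOf (denC K) e ⊎ EdgeOf (shift sK (den q)) e) ⊎ e ≡ (sK , n)
    classify {e} m with edges-++ (inner K ++ shift sK (den q)) [ outer K ++ [ n ] ] m
    ... | inj₁ m1 with edges-++ (inner K) (shift sK (den q)) m1
    ...   | inj₁ m2 = inj₁ (inj₁ (edges-++ˡ (inner K) [ outer K ] m2))
    ...   | inj₂ m2 = inj₁ (inj₂ m2)
    classify {e} m | inj₂ m1 with ∈-++⁻ (consec (outer K ++ [ n ])) m1
    ... | inj₂ ()
    ... | inj₁ m2 with consec-snoc 1 (otail K) n m2
    ...   | inj₁ m3 = inj₁ (inj₁ (edges-++ʳ (inner K) [ outer K ] (∈-++⁺ˡ m3)))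
    ...   | inj₂ eq = inj₂ (trans eq (cong (_, n) (last-outer K)))

den-isNC : ∀ p → IsNC (size p) (den p)
den-isNC p = record
  { partition = record
    { nonempty = den-nonempty p
    ; increasing = den-increasing p
    ; ordered = APP.map⁺ (den-sorted p)
    ; disjoint = den-unique p
    ; covers = den-covers p }
  ; noncrossing = den-NC p }

-- The operations ⊎, * and decomp on denotations are syntactic.

⊎-hom : ∀ p q → ⟦ p ⟧ ⊎ₚ ⟦ q ⟧ ≡ ⟦ p ++P q ⟧
⊎-hom p q = cong₂ _,_ (sym (size-++ p q))
  (trans (cong canon (sym (den-++ p q))) (canon-sorted _ (den-sorted (p ++P q))))

den-single : ∀ K → den (ε ▷ K) ≡ denC K
den-single K = shift0 (denC K)

*-hom-ext : ∀ K q → (sizeC K , denC K) *ₚ ⟦ q ⟧ ≡ (sizeC (ext K q) , denC (ext K q))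
*-hom-ext K q = cong (sizeC (ext K q) ,_) (begin
    canon (map f (inner K ++ [ outer K ]) ++ S)
  ≡⟨ cong (λ u → canon (u ++ S)) mark-outer ⟩
    canon ((inner K ++ [ O' ]) ++ S)
  ≡⟨ cong canon (++-assoc (inner K) [ O' ] S) ⟩
    canon (inner K ++ (O' ∷ S))
  ≡⟨ canon-move-last (inner K) O' S (denC-sorted (ext K q)) ⟩
    (inner K ++ S) ++ [ O' ] ∎)
  where
  open ≡-Reasoning
  n = sizeC (ext K q)
  f : Block → Block
  f B = if sizeC K ∈ᵇ B then B ++ [ n ] else B
  S = shift (sizeC K) (den q)
  O' = outer K ++ [ n ]
  inner-fixed : ∀ bs → InRange 1 (sizeC⁻ K) bs → All (λ B → f B ≡ B) bs
  inner-fixed [] [] = []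
  inner-fixed (B ∷ bs) (r ∷ rs) = e ∷ inner-fixed bs rs
    where
    e : f B ≡ B
    e rewrite ∈ᵇ-false B (All-map (λ {y} iy eq → 1+n≰n (subst (_≤ sizeC⁻ K) (sym eq) (proj₂ iy))) r) = refl
  outer-marked : f (outer K) ≡ O'
  outer-marked rewrite ∈ᵇ-true (outer K) (sizeC∈outer K) = refl
  mark-outer : map f (inner K ++ [ outer K ]) ≡ inner K ++ [ O' ]
  mark-outer = trans (map-++ f (inner K) [ outer K ])
                     (cong₂ (λ u v → u ++ [ v ]) (map-id-local (inner-fixed (inner K) (inner-range K))) outer-marked)

*-hom : ∀ m q → ⟦ m ⟧M *ₚ ⟦ q ⟧ ≡ ⟦ star m q ⟧
*-hom nothing q = trans (cong (λ m → (m , canon (den q ++ [ [ m ] ]))) (sym (+-comm (size q) 1)))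
                        (cong (size q + 1 ,_) (canon-sorted _ (den-sorted (q ▷ unit))))
*-hom (just K) q = trans (*-hom-ext K q) (cong (sizeC (ext K q) ,_) (sym (den-single (ext K q))))

restrict-prefix : ∀ n p zs {hi} → InRange (suc (size p)) hi zs → restrict (n , den p ++ zs) 1 (size p) ≡ ⟦ p ⟧
restrict-prefix n p zs rz = cong (size p ,_) (begin
    canon (restrictAll 1 (size p) (den p ++ zs))
  ≡⟨ cong canon (restrictAll-++ 1 (size p) (den p) zs) ⟩
    canon (restrictAll 1 (size p) (den p) ++ restrictAll 1 (size p) zs)
  ≡⟨ cong₂ (λ u v → canon (u ++ v)) (restrictAll-in 0 (size p) (den p) (den-range p) (den-nonempty p)) (restrictAll-out 1 (size p) zs (InRange-above rz ≤-refl)) ⟩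
    canon (map (map (_∸ 0)) (den p) ++ [])
  ≡⟨ cong canon (trans (++-identityʳ _) (unshift0 (den p))) ⟩
    canon (den p)
  ≡⟨ canon-sorted (den p) (den-sorted p) ⟩
    den p ∎)
  where open ≡-Reasoning

decomp-unit : ∀ p → decomp₁ ⟦ p ▷ unit ⟧ ≡ (⟦ p ⟧ , ∅ₚ , ∅ₚ) × decomp₂ ⟦ p ▷ unit ⟧ ≡ (∅ₚ , ∅ₚ , ⟦ p ⟧)
decomp-unit p = trans (decomp₁-single {c + 1} {den p ++ [ [ c + 1 ] ]} findBlock-n refl) (cong (λ u → (u , ∅ₚ , ∅ₚ)) rr) ,
             trans (decomp₂-single {c + 1} {den p ++ [ [ c + 1 ] ]} findBlock-n refl) (cong (λ u → (∅ₚ , ∅ₚ , u)) rr)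
  where
  c = size p
  findBlock-n : findBlock (c + 1) (den p ++ [ [ c + 1 ] ]) ≡ just [ c + 1 ]
  findBlock-n = trans (findBlock-skip (c + 1) (den p) _ (∉-InRange (den p) (den-range p) (≤-reflexive (sym (+-comm c 1)))))
             (findBlock-here (c + 1) [ c + 1 ] [] (∈ᵇ-true [ c + 1 ] (here refl)))
  rr : restrict (c + 1 , den p ++ [ [ c + 1 ] ]) 1 (c + 1 ∸ 1) ≡ ⟦ p ⟧
  rr = trans (cong (restrict (c + 1 , den p ++ [ [ c + 1 ] ]) 1) (m+n∸n≡m c 1))
             (restrict-prefix (c + 1) p [ [ c + 1 ] ] ((((≤-reflexive (sym (+-comm c 1))) , ≤-refl) ∷ []) ∷ []))

-- Both decompositions of p ▷ ext K q return (p , K , q): the block of the last point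
-- n is the shifted outer block of K with n added; its minimum is the first point of
-- the component and its second largest element is the last point of K.
module ComponentDecomp (p : Term) (K : Conn) (q : Term) where
  c = size p
  a = sizeC⁻ K
  b = size q
  sK = sizeC K
  n = c + sizeC (ext K q)
  Bl = map (c +_) (outer (ext K q))
  π = ⟦ p ▷ ext K q ⟧

  -- Position bounds: p occupies [1, c], the inner blocks of K end by c + a,
  -- q occupies [c + sK + 1, c + sK + b], and n = c + sK + b + 1 is the last point.
  c<n : c < n
  c<n = m<m+n c (s≤s z≤n)
  c+a<n : c + a < n
  c+a<n = +-monoʳ-< c (s≤s (≤-trans (m≤m+n a b) (m≤m+n (a + b) 1)))
  c+sK+b<n : c + sK + b < n
  c+sK+b<n = subst (_< n) (sym (+-assoc c sK b)) (+-monoʳ-< c (s≤s (m<m+n (a + b) (s≤s z≤n))))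
  n∸1≡c+sK+b : n ∸ 1 ≡ c + sK + b
  n∸1≡c+sK+b = begin
      c + suc (a + b + 1) ∸ 1  ≡⟨ cong (_∸ 1) (+-suc c (a + b + 1)) ⟩
      c + (a + b + 1)          ≡⟨ cong (c +_) (+-comm (a + b) 1) ⟩
      c + (sK + b)             ≡⟨ sym (+-assoc c sK b) ⟩
      c + sK + b ∎
    where open ≡-Reasoning

  Bl-eq : Bl ≡ map (c +_) (outer K) ++ [ n ]
  Bl-eq = map-++ (c +_) (outer K) [ sizeC (ext K q) ]

  bs-eq : den (p ▷ ext K q) ≡ den p ++ (shift c (inner K) ++ (shift (c + sK) (den q) ++ [ Bl ]))
  bs-eq = cong (den p ++_) (begin
      shift c ((inner K ++ shift sK (den q)) ++ [ outer (ext K q) ])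
    ≡⟨ shift-++ c (inner K ++ shift sK (den q)) _ ⟩
      shift c (inner K ++ shift sK (den q)) ++ [ Bl ]
    ≡⟨ cong (_++ [ Bl ]) (shift-++ c (inner K) _) ⟩
      (shift c (inner K) ++ shift c (shift sK (den q))) ++ [ Bl ]
    ≡⟨ cong (λ u → (shift c (inner K) ++ u) ++ [ Bl ]) (shift-shift c sK (den q)) ⟩
      (shift c (inner K) ++ shift (c + sK) (den q)) ++ [ Bl ]
    ≡⟨ ++-assoc (shift c (inner K)) _ _ ⟩
      shift c (inner K) ++ (shift (c + sK) (den q) ++ [ Bl ]) ∎)
    where open ≡-Reasoning

  range-inner : InRange (c + 1) (c + a) (shift c (inner K))
  range-inner = InRange-shift c (inner-range K)
  range-q : InRange (c + sK + 1) (c + sK + b) (shift (c + sK) (den q))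
  range-q = InRange-shift (c + sK) (den-range q)
  range-outer : All (Between (c + 1) (c + sK)) (map (c +_) (outer K))
  range-outer = AllP.map⁺ (All-map (λ { (u , v) → +-monoʳ-≤ c u , +-monoʳ-≤ c v }) (outer-range K))

  findBlock-n : findBlock n (den (p ▷ ext K q)) ≡ just Bl
  findBlock-n rewrite bs-eq =
    trans (findBlock-skip n (den p) _ (∉-InRange (den p) (den-range p) c<n))
    (trans (findBlock-skip n (shift c (inner K)) _ (∉-InRange _ range-inner c+a<n))
    (trans (findBlock-skip n (shift (c + sK) (den q)) _ (∉-InRange _ range-q c+sK+b<n))
           (findBlock-here n Bl [] (∈ᵇ-true Bl (∈-map⁺ (c +_) (sizeC∈outer (ext K q)))))))

  lenBl : (length Bl ≡ᵇ 1) ≡ false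
  lenBl = ≡ᵇ-false (λ e → length-snoc≢0 (otail K) (sizeC (ext K q)) (suc-injective (trans (sym (length-map (c +_) (outer (ext K q)))) e)))

  minBl : minB Bl ≡ suc c
  minBl = trans (minB-head (c + 1) _ (AllP.map⁺ (All-map (λ { (u , v) → +-monoʳ-≤ c (≤-trans (s≤s z≤n) u) }) (otail-range (ext K q)))))
                (+-comm c 1)

  maxBl : maxB (filterᵇ (_<ᵇ n) Bl) ≡ c + sK
  maxBl = begin
      maxB (filterᵇ (_<ᵇ n) Bl)
    ≡⟨ cong (λ u → maxB (filterᵇ (_<ᵇ n) u)) Bl-eq ⟩
      maxB (filterᵇ (_<ᵇ n) (map (c +_) (outer K) ++ [ n ]))
    ≡⟨ cong maxB (filterᵇ-++ (_<ᵇ n) (map (c +_) (outer K)) [ n ]) ⟩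
      maxB (filterᵇ (_<ᵇ n) (map (c +_) (outer K)) ++ filterᵇ (_<ᵇ n) [ n ])
    ≡⟨ cong₂ (λ u v → maxB (u ++ v))
         (filterᵇ-all (_<ᵇ n) _ (All-map (λ i → <ᵇ-true (≤-<-trans (proj₂ i) (≤-<-trans (m≤m+n (c + sK) b) c+sK+b<n))) range-outer))
         (filterᵇ-none (_<ᵇ n) [ n ] (<ᵇ-false {n} {n} ≤-refl ∷ [])) ⟩
      maxB (map (c +_) (outer K) ++ [])
    ≡⟨ cong maxB (++-identityʳ (map (c +_) (outer K))) ⟩
      maxB (map (c +_) (outer K))
    ≡⟨ maxB-shift c (outer K) (λ ()) ⟩
      c + maxB (outer K)
    ≡⟨ cong (c +_) (maxB-outer K) ⟩
      c + sK ∎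
    where open ≡-Reasoning

  bs = den (p ▷ ext K q)

  restrictAll-pieces : ∀ l r → restrictAll l r (den (p ▷ ext K q)) ≡
    restrictAll l r (den p) ++ (restrictAll l r (shift c (inner K)) ++
      (restrictAll l r (shift (c + sK) (den q)) ++ restrictAll l r [ Bl ]))
  restrictAll-pieces l r =
    trans (cong (restrictAll l r) bs-eq)
    (trans (restrictAll-++ l r (den p) _) (cong (restrictAll l r (den p) ++_)
    (trans (restrictAll-++ l r (shift c (inner K)) _) (cong (restrictAll l r (shift c (inner K)) ++_)
           (restrictAll-++ l r (shift (c + sK) (den q)) [ Bl ])))))

  restrict-before : restrict π 1 c ≡ ⟦ p ⟧
  restrict-before = restrict-prefix n p (shift c (denC (ext K q))) (InRange-weaken (≤-reflexive (sym (+-comm c 1))) ≤-refl (InRange-shift c (denC-range (ext K q))))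

  restrictBlock-Bl : restrictBlock (suc c) (c + sK) Bl ≡ outer K
  restrictBlock-Bl = begin
      restrictBlock (suc c) (c + sK) Bl
    ≡⟨ cong (restrictBlock (suc c) (c + sK)) Bl-eq ⟩
      restrictBlock (suc c) (c + sK) (map (c +_) (outer K) ++ [ n ])
    ≡⟨ restrictBlock-++ (suc c) (c + sK) (map (c +_) (outer K)) [ n ] ⟩
      restrictBlock (suc c) (c + sK) (map (c +_) (outer K)) ++ restrictBlock (suc c) (c + sK) [ n ]
    ≡⟨ cong₂ _++_ (restrictBlock-in c (c + sK) _ (All-map (Between-weaken (≤-reflexive (sym (+-comm c 1))) ≤-refl) range-outer))
                  (restrictBlock-out (suc c) (c + sK) [ n ] (inj₂ (≤-<-trans (m≤m+n (c + sK) b) c+sK+b<n) ∷ [])) ⟩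
      map (_∸ c) (map (c +_) (outer K)) ++ []
    ≡⟨ trans (++-identityʳ _) (unshiftB c (outer K)) ⟩
      outer K ∎
    where open ≡-Reasoning

  restrict-component : restrict π (suc c) (c + sK) ≡ (sK , denC K)
  restrict-component = cong₂ _,_ (m+n∸m≡n c sK) (begin
      canon (restrictAll (suc c) (c + sK) bs)
    ≡⟨ cong canon (restrictAll-pieces (suc c) (c + sK)) ⟩
      canon (restrictAll (suc c) (c + sK) (den p) ++ (restrictAll (suc c) (c + sK) (shift c (inner K)) ++
             (restrictAll (suc c) (c + sK) (shift (c + sK) (den q)) ++ restrictAll (suc c) (c + sK) [ Bl ])))
    ≡⟨ cong₂ (λ u v → canon (u ++ v))
        (restrictAll-out (suc c) (c + sK) (den p) (InRange-below (den-range p) ≤-refl))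
        (cong₂ _++_
          (trans (restrictAll-in c (c + sK) _ (InRange-weaken (≤-reflexive (sym (+-comm c 1))) (+-monoʳ-≤ c (n≤1+n a)) range-inner) (NonEmptyAll-shift c (inner-nonempty K)))
                 (unshift c (inner K)))
          (cong₂ _++_ (restrictAll-out (suc c) (c + sK) _ (InRange-above range-q (≤-reflexive (sym (+-comm (c + sK) 1)))))
                      (restrictAll-single (suc c) (c + sK) Bl 1 (otail K) restrictBlock-Bl))) ⟩
      canon (inner K ++ [ outer K ])
    ≡⟨ canon-sorted _ (denC-sorted K) ⟩
      denC K ∎)
    where open ≡-Reasoning

  r3 = c + sK + b

  restrict-after′ : restrict π (suc (c + sK)) r3 ≡ ⟦ q ⟧
  restrict-after′ = cong₂ _,_ (m+n∸m≡n (c + sK) b) (begin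
      canon (restrictAll l r3 bs)
    ≡⟨ cong canon (restrictAll-pieces l r3) ⟩
      canon (restrictAll l r3 (den p) ++ (restrictAll l r3 (shift c (inner K)) ++
             (restrictAll l r3 (shift (c + sK) (den q)) ++ restrictAll l r3 [ Bl ])))
    ≡⟨ cong₂ (λ u v → canon (u ++ v))
        (restrictAll-out l r3 (den p) (InRange-below (den-range p) (s≤s (m≤m+n c sK))))
        (cong₂ _++_
          (restrictAll-out l r3 _ (InRange-below range-inner (s≤s (+-monoʳ-≤ c (n≤1+n a)))))
          (cong₂ _++_ (trans (restrictAll-in (c + sK) r3 _ (InRange-weaken (≤-reflexive (sym (+-comm (c + sK) 1))) ≤-refl range-q) (NonEmptyAll-shift (c + sK) (den-nonempty q)))
                             (unshift (c + sK) (den q)))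
                      (restrictAll-out l r3 [ Bl ] (subst (All (Outside l r3)) (sym Bl-eq)
                          (AllP.++⁺ (All-map (λ i → inj₁ (s≤s (proj₂ i))) range-outer) (inj₂ c+sK+b<n ∷ [])) ∷ [])))) ⟩
      canon ([] ++ ([] ++ (den q ++ [])))
    ≡⟨ cong canon (++-identityʳ (den q)) ⟩
      canon (den q)
    ≡⟨ canon-sorted _ (den-sorted q) ⟩
      den q ∎)
    where
    open ≡-Reasoning
    l = suc (c + sK)

  restrict-after : restrict π (suc (c + sK)) (n ∸ 1) ≡ ⟦ q ⟧
  restrict-after = trans (cong (restrict π (suc (c + sK))) n∸1≡c+sK+b) restrict-after′

  gen : decompGen π Bl ≡ (⟦ p ⟧ , (sK , denC K) , ⟦ q ⟧)
  gen = trans (cong₂ (λ u v → (restrict π 1 (u ∸ 1) , restrict π u v , restrict π (suc v) (n ∸ 1))) minBl maxBl)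
              (cong₂ _,_ restrict-before (cong₂ _,_ restrict-component restrict-after))

  decomp-ext : decomp₁ π ≡ (⟦ p ⟧ , (sK , denC K) , ⟦ q ⟧) × decomp₂ π ≡ (⟦ p ⟧ , (sK , denC K) , ⟦ q ⟧)
  decomp-ext = trans (decomp₁-gen {n} {bs} findBlock-n lenBl) gen , trans (decomp₂-gen {n} {bs} findBlock-n lenBl) gen

open ComponentDecomp public using (decomp-ext)

units-∈ : ∀ m i → 1 ≤ i → i ≤ m → [ i ] ∈ den (unitsP m)
units-∈ zero i a b = ⊥-elim (<⇒≱ a b)
units-∈ (suc m) i a b with m≤n⇒m<n∨m≡n b
... | inj₁ lt = ∈-++⁺ˡ (units-∈ m i a (≤-pred lt))
... | inj₂ refl = ∈-++⁺ʳ (den (unitsP m)) (here (cong [_] (sym (trans (cong (_+ 1) (size-units m)) (+-comm m 1)))))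

lastNonSingleton-units : ∀ c m bs → Unique (concat bs) → (∀ i → 1 ≤ i → i ≤ m → [ c + i ] ∈ bs) →
            ∀ j → j ≤ m → lastNonSingleton (c + j) bs ≡ lastNonSingleton c bs
lastNonSingleton-units c m bs u h zero _ = cong (λ v → lastNonSingleton v bs) (+-identityʳ c)
lastNonSingleton-units c m bs u h (suc j) le =
  trans (cong (λ v → lastNonSingleton v bs) (+-suc c j))
  (trans (lastNonSingleton-step (c + j) bs (trans (singletonBlock-eq {suc (c + j)} {bs}
            (findBlock-unique bs u (here (sym (+-suc c j))) (h (suc j) (s≤s z≤n) le))) refl))
         (lastNonSingleton-units c m bs u h j (≤-trans (n≤1+n j) le)))

upTo-units : ∀ m → map (λ i → suc i ∷ []) (upTo m) ≡ den (unitsP m)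
upTo-units zero = refl
upTo-units (suc m) = begin
    map f (upTo (suc m))
  ≡⟨ cong (map f) (sym (applyUpTo-∷ʳ id m)) ⟩
    map f (upTo m ++ [ m ])
  ≡⟨ map-++ f (upTo m) [ m ] ⟩
    map f (upTo m) ++ [ [ suc m ] ]
  ≡⟨ cong₂ (λ u v → u ++ [ [ v ] ]) (upTo-units m) (sym (trans (cong (_+ 1) (size-units m)) (+-comm m 1))) ⟩
    den (unitsP m) ++ [ [ size (unitsP m) + 1 ] ] ∎
  where
  open ≡-Reasoning
  f : ℕ → Block
  f i = suc i ∷ []

-- ξ on denotations is the syntactic map ξS.

-- An entry (σᵢ , σ'ᵢ) of the decomposition chains: σᵢ is ∅ (nothing) or connected.
Link : Set
Link = Maybe Conn × Term

linkPart : Link → Part × Part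
linkPart (m , s) = ⟦ m ⟧M , ⟦ s ⟧

chain₁S : Term → List Link
chain₁S ε = []
chain₁S (p ▷ unit) = (nothing , ε) ∷ chain₁S p
chain₁S (p ▷ ext K q) = (just K , q) ∷ chain₁S p

chain₂S : Term → List Link
chain₂S ε = []
chain₂S (p ▷ unit) = (nothing , ε) ∷ chain₂S p
chain₂S (p ▷ ext K q) = (just K , p) ∷ chain₂S q

MseqS : List Link → Term
MseqS [] = ε
MseqS ((m , s) ∷ cs) = s ++P star m (MseqS cs)

baseS : List Link → Term
baseS [] = ε
baseS ((m , s) ∷ rest) = star m (MseqS rest)

tailL : ∀ {A : Set} → List A → List A
tailL [] = []
tailL (_ ∷ xs) = xs

prependStar : Term → Link → Term
prependStar acc (m , s) = star m s ++P acc

ξcoreS : Term → Term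
ξcoreS p = foldl prependStar (baseS (chain₁S p)) (tailL (chain₂S p))

ξS : Term → Term
ξS ε = ε
ξS (p ▷ unit) = ξS p ▷ unit
ξS (p ▷ ext K q) = ξcoreS (p ▷ ext K q)

prependStarₚ : Part → Part × Part → Part
prependStarₚ acc p = (proj₁ p *ₚ proj₂ p) ⊎ₚ acc

baseₚ : List (Part × Part) → Part
baseₚ [] = ∅ₚ
baseₚ ((σ , _) ∷ rest) = σ *ₚ Mseq rest

ξcore-unfold : ∀ π x rest y rest2 → chain₁ (proj₁ π) π ≡ x ∷ rest → chain₂ (proj₁ π) π ≡ y ∷ rest2 →
           ξcore π ≡ foldl prependStarₚ (baseₚ (x ∷ rest)) rest2
ξcore-unfold π x rest y rest2 e1 e2 rewrite e1 | e2 = refl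

chain₁-step : ∀ f {N} bs → 0 < N → chain₁ (suc f) (N , bs) ≡
  (proj₁ (proj₂ (decomp₁ (N , bs))) , proj₂ (proj₂ (decomp₁ (N , bs)))) ∷ chain₁ f (proj₁ (decomp₁ (N , bs)))
chain₁-step f bs (s≤s z≤n) = refl

chain₂-step : ∀ f {N} bs → 0 < N → chain₂ (suc f) (N , bs) ≡
  (proj₁ (proj₂ (decomp₂ (N , bs))) , proj₁ (decomp₂ (N , bs))) ∷ chain₂ f (proj₂ (proj₂ (decomp₂ (N , bs))))
chain₂-step f bs (s≤s z≤n) = refl

size-pos : ∀ p K → 0 < size (p ▷ K)
size-pos p K = ≤-trans (s≤s z≤n) (m≤n+m (sizeC K) (size p))

le-split : ∀ a x f → a + suc x ≤ suc f → (a ≤ f) × (x ≤ f)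
le-split a x f le = let l = ≤-pred (subst (_≤ suc f) (+-suc a x) le) in
  ≤-trans (m≤m+n a x) l , ≤-trans (m≤n+m x a) l

chain₁-hom : ∀ p f → size p ≤ f → chain₁ f ⟦ p ⟧ ≡ map linkPart (chain₁S p)
chain₁-hom ε zero _ = refl
chain₁-hom ε (suc f) _ = refl
chain₁-hom (p ▷ K) zero le = ⊥-elim (<⇒≱ (size-pos p K) le)
chain₁-hom (p ▷ unit) (suc f) le =
  trans (chain₁-step f (den (p ▷ unit)) (size-pos p unit))
  (trans (cong (λ d → (proj₁ (proj₂ d) , proj₂ (proj₂ d)) ∷ chain₁ f (proj₁ d)) (proj₁ (decomp-unit p)))
         (cong (_ ∷_) (chain₁-hom p f (proj₁ (le-split (size p) 0 f le)))))
chain₁-hom (p ▷ ext K q) (suc f) le =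
  trans (chain₁-step f (den (p ▷ ext K q)) (size-pos p (ext K q)))
  (trans (cong (λ d → (proj₁ (proj₂ d) , proj₂ (proj₂ d)) ∷ chain₁ f (proj₁ d)) (proj₁ (decomp-ext p K q)))
         (cong (_ ∷_) (chain₁-hom p f (proj₁ (le-split (size p) _ f le)))))

chain₂-hom : ∀ p f → size p ≤ f → chain₂ f ⟦ p ⟧ ≡ map linkPart (chain₂S p)
chain₂-hom ε zero _ = refl
chain₂-hom ε (suc f) _ = refl
chain₂-hom (p ▷ K) zero le = ⊥-elim (<⇒≱ (size-pos p K) le)
chain₂-hom (p ▷ unit) (suc f) le =
  trans (chain₂-step f (den (p ▷ unit)) (size-pos p unit))
  (trans (cong (λ d → (proj₁ (proj₂ d) , proj₁ d) ∷ chain₂ f (proj₂ (proj₂ d))) (proj₂ (decomp-unit p)))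
         (cong (_ ∷_) (chain₂-hom p f (proj₁ (le-split (size p) 0 f le)))))
chain₂-hom (p ▷ ext K q) (suc f) le =
  trans (chain₂-step f (den (p ▷ ext K q)) (size-pos p (ext K q)))
  (trans (cong (λ d → (proj₁ (proj₂ d) , proj₁ d) ∷ chain₂ f (proj₂ (proj₂ d))) (proj₂ (decomp-ext p K q)))
         (cong (_ ∷_) (chain₂-hom q f (≤-trans (≤-trans (m≤n+m (size q) (sizeC⁻ K)) (m≤m+n _ 1)) (proj₂ (le-split (size p) _ f le))))))

Mseq-hom : ∀ cs → Mseq (map linkPart cs) ≡ ⟦ MseqS cs ⟧
Mseq-hom [] = refl
Mseq-hom ((m , s) ∷ cs) = trans (cong (λ u → ⟦ s ⟧ ⊎ₚ (⟦ m ⟧M *ₚ u)) (Mseq-hom cs))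
  (trans (cong (⟦ s ⟧ ⊎ₚ_) (*-hom m (MseqS cs))) (⊎-hom s (star m (MseqS cs))))

foldl-hom : ∀ cs B → foldl prependStarₚ ⟦ B ⟧ (map linkPart cs) ≡ ⟦ foldl prependStar B cs ⟧
foldl-hom [] B = refl
foldl-hom ((m , s) ∷ cs) B = trans (cong (λ u → foldl prependStarₚ u (map linkPart cs))
  (trans (cong (_⊎ₚ ⟦ B ⟧) (*-hom m s)) (⊎-hom (star m s) B))) (foldl-hom cs (star m s ++P B))

ξcore-hom : ∀ p K q → ξcore ⟦ p ▷ ext K q ⟧ ≡ ⟦ ξcoreS (p ▷ ext K q) ⟧
ξcore-hom p K q = begin
    ξcore ⟦ p ▷ ext K q ⟧
  ≡⟨ ξcore-unfold ⟦ p ▷ ext K q ⟧ _ _ _ _ (chain₁-hom (p ▷ ext K q) _ ≤-refl) (chain₂-hom (p ▷ ext K q) _ ≤-refl) ⟩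
    foldl prependStarₚ ((sizeC K , denC K) *ₚ Mseq (map linkPart (chain₁S p))) (map linkPart (chain₂S q))
  ≡⟨ cong (λ u → foldl prependStarₚ ((sizeC K , denC K) *ₚ u) (map linkPart (chain₂S q))) (Mseq-hom (chain₁S p)) ⟩
    foldl prependStarₚ ((sizeC K , denC K) *ₚ ⟦ MseqS (chain₁S p) ⟧) (map linkPart (chain₂S q))
  ≡⟨ cong (λ u → foldl prependStarₚ u (map linkPart (chain₂S q))) (*-hom (just K) (MseqS (chain₁S p))) ⟩
    foldl prependStarₚ ⟦ star (just K) (MseqS (chain₁S p)) ⟧ (map linkPart (chain₂S q))
  ≡⟨ foldl-hom (chain₂S q) (star (just K) (MseqS (chain₁S p))) ⟩
    ⟦ ξcoreS (p ▷ ext K q) ⟧ ∎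
  where open ≡-Reasoning

data View : Term → Set where
  allUnits : ∀ m → View (unitsP m)
  lastComponent : ∀ p K q m → View ((p ▷ ext K q) ++P unitsP m)

view : ∀ p → View p
view ε = allUnits 0
view (p ▷ ext K q) = lastComponent p K q 0
view (p ▷ unit) with view p
... | allUnits m = allUnits (suc m)
... | lastComponent p' K q m = lastComponent p' K q (suc m)

ξS-units : ∀ m → ξS (unitsP m) ≡ unitsP m
ξS-units zero = refl
ξS-units (suc m) = cong (_▷ unit) (ξS-units m)

ξS-++units : ∀ p m → ξS (p ++P unitsP m) ≡ ξS p ++P unitsP m
ξS-++units p zero = refl
ξS-++units p (suc m) = cong (_▷ unit) (ξS-++units p m)

ξ-hom-units : ∀ m → ξₚ ⟦ unitsP m ⟧ ≡ ⟦ ξS (unitsP m) ⟧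
ξ-hom-units m = trans (ξₚ-nothing _ bs lns) (cong ⟦_⟧ (sym (ξS-units m)))
  where
  bs = den (unitsP m)
  lns : lastNonSingleton (size (unitsP m)) bs ≡ nothing
  lns = trans (cong (λ v → lastNonSingleton v bs) (size-units m))
        (lastNonSingleton-units 0 m bs (den-unique (unitsP m)) (λ i a b → units-∈ m i a b) m ≤-refl)

-- ξ on (p ▷ ext K q) ++P unitsP m: the last non-singleton is the end of the
-- component, so ξ acts by ξcoreS there and keeps the m singletons.
module ξOnComponent (p : Term) (K : Conn) (q : Term) (m : ℕ) where
  P' = p ▷ ext K q
  X = P' ++P unitsP m
  c = size P'
  bs = den X
  N = size X
  bs-eq : bs ≡ den P' ++ shift c (den (unitsP m))
  bs-eq = den-++ P' (unitsP m)
  N-eq : N ≡ c + m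
  N-eq = trans (size-++ P' (unitsP m)) (cong (c +_) (size-units m))
  u = den-unique X
  Bl = map (size p +_) (outer (ext K q))
  Bl∈bs : Bl ∈ bs
  Bl∈bs = subst (Bl ∈_) (sym bs-eq) (∈-++⁺ˡ (∈-++⁺ʳ (den p) (∈-map⁺ (map (size p +_)) (∈-++⁺ʳ (inner (ext K q)) (here refl)))))
  c∈Bl : c ∈ Bl
  c∈Bl = ∈-map⁺ (size p +_) (sizeC∈outer (ext K q))
  c-not-singleton : singletonBlock c bs ≡ false
  c-not-singleton = trans (singletonBlock-eq {c} {bs} (findBlock-unique bs u c∈Bl Bl∈bs)) (ComponentDecomp.lenBl p K q)
  c' = size p + sizeC⁻ (ext K q)
  c-suc : c ≡ suc c'
  c-suc = +-suc (size p) (sizeC⁻ (ext K q))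
  lastNonSingleton-c : lastNonSingleton c bs ≡ just c
  lastNonSingleton-c = subst (λ v → lastNonSingleton v bs ≡ just v) (sym c-suc) (lastNonSingleton-stop c' bs (subst (λ v → singletonBlock v bs ≡ false) c-suc c-not-singleton))
  singletons-after-c : ∀ i → 1 ≤ i → i ≤ m → [ c + i ] ∈ bs
  singletons-after-c i a b = subst ([ c + i ] ∈_) (sym bs-eq) (∈-++⁺ʳ (den P') (∈-map⁺ (map (c +_)) (units-∈ m i a b)))
  lastNonSingleton-N : lastNonSingleton N bs ≡ just c
  lastNonSingleton-N = trans (cong (λ v → lastNonSingleton v bs) N-eq) (trans (lastNonSingleton-units c m bs u singletons-after-c m ≤-refl) lastNonSingleton-c)
  restrict-front : restrict (N , bs) 1 c ≡ ⟦ P' ⟧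
  restrict-front = trans (cong (λ v → restrict (N , v) 1 c) bs-eq)
         (restrict-prefix N P' (shift c (den (unitsP m))) (InRange-weaken (≤-reflexive (sym (+-comm c 1))) ≤-refl (InRange-shift c (den-range (unitsP m)))))
  N∸c≡m : N ∸ c ≡ m
  N∸c≡m = trans (cong (_∸ c) N-eq) (m+n∸m≡n c m)
  ξ-hom-ext : ξₚ ⟦ X ⟧ ≡ ⟦ ξS X ⟧
  ξ-hom-ext = begin
      ξₚ (N , bs)
    ≡⟨ ξₚ-just N bs c lastNonSingleton-N ⟩
      ξcore (restrict (N , bs) 1 c) ⊎ₚ ((N ∸ c) , map (λ i → suc i ∷ []) (upTo (N ∸ c)))
    ≡⟨ cong₂ (λ u v → ξcore u ⊎ₚ (v , map (λ i → suc i ∷ []) (upTo v))) restrict-front N∸c≡m ⟩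
      ξcore ⟦ P' ⟧ ⊎ₚ (m , map (λ i → suc i ∷ []) (upTo m))
    ≡⟨ cong₂ _⊎ₚ_ (ξcore-hom p K q) (cong₂ _,_ (sym (size-units m)) (upTo-units m)) ⟩
      ⟦ ξcoreS P' ⟧ ⊎ₚ ⟦ unitsP m ⟧
    ≡⟨ ⊎-hom (ξcoreS P') (unitsP m) ⟩
      ⟦ ξcoreS P' ++P unitsP m ⟧
    ≡⟨ cong ⟦_⟧ (sym (ξS-++units P' m)) ⟩
      ⟦ ξS X ⟧ ∎
    where open ≡-Reasoning

ξ-hom : ∀ p → ξₚ ⟦ p ⟧ ≡ ⟦ ξS p ⟧
ξ-hom p with view p
... | allUnits m = ξ-hom-units m
... | lastComponent p' K q m = ξOnComponent.ξ-hom-ext p' K q m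

-- ξS is an involution.

data WellFormed : Link → Set where
  wf-unit : WellFormed (nothing , ε)
  wf-ext : ∀ K s → WellFormed (just K , s)

chain₁-wellFormed : ∀ p → All WellFormed (chain₁S p)
chain₁-wellFormed ε = []
chain₁-wellFormed (p ▷ unit) = wf-unit ∷ chain₁-wellFormed p
chain₁-wellFormed (p ▷ ext K q) = wf-ext K q ∷ chain₁-wellFormed p

chain₂-wellFormed : ∀ p → All WellFormed (chain₂S p)
chain₂-wellFormed ε = []
chain₂-wellFormed (p ▷ unit) = wf-unit ∷ chain₂-wellFormed p
chain₂-wellFormed (p ▷ ext K q) = wf-ext K p ∷ chain₂-wellFormed q

-- Inverse of chain₁S: reassemble σ'₁ ⋯ as a term from its links.
unchain : List Link → Term
unchain cs = foldl prependStar ε cs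

unchain-acc : ∀ cs B → foldl prependStar B cs ≡ unchain cs ++P B
unchain-acc [] B = sym (++P-identityˡ B)
unchain-acc ((m , s) ∷ cs) B = begin
    foldl prependStar (star m s ++P B) cs
  ≡⟨ unchain-acc cs (star m s ++P B) ⟩
    unchain cs ++P (star m s ++P B)
  ≡⟨ sym (++P-assoc (unchain cs) (star m s) B) ⟩
    (unchain cs ++P star m s) ++P B
  ≡⟨ cong (_++P B) (sym (unchain-acc cs (star m s))) ⟩
    foldl prependStar (star m s) cs ++P B ∎
  where open ≡-Reasoning

unchain-cons : ∀ c cs → unchain (c ∷ cs) ≡ unchain cs ++P star (proj₁ c) (proj₂ c)
unchain-cons (m , s) cs = unchain-acc cs (star m s ++P ε)

chain₁-++ : ∀ X Y → chain₁S (X ++P Y) ≡ chain₁S Y ++ chain₁S X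
chain₁-++ X ε = refl
chain₁-++ X (Y ▷ unit) = cong (_ ∷_) (chain₁-++ X Y)
chain₁-++ X (Y ▷ ext K q) = cong (_ ∷_) (chain₁-++ X Y)

chain₁-star : ∀ c → WellFormed c → chain₁S (star (proj₁ c) (proj₂ c)) ≡ [ c ]
chain₁-star _ wf-unit = refl
chain₁-star _ (wf-ext K s) = refl

chain₁-unchain : ∀ cs → All WellFormed cs → chain₁S (unchain cs) ≡ cs
chain₁-unchain [] [] = refl
chain₁-unchain (c ∷ cs) (g ∷ gs) = begin
    chain₁S (unchain (c ∷ cs))
  ≡⟨ cong chain₁S (unchain-cons c cs) ⟩
    chain₁S (unchain cs ++P star (proj₁ c) (proj₂ c))
  ≡⟨ chain₁-++ (unchain cs) _ ⟩
    chain₁S (star (proj₁ c) (proj₂ c)) ++ chain₁S (unchain cs)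
  ≡⟨ cong₂ _++_ (chain₁-star c g) (chain₁-unchain cs gs) ⟩
    c ∷ cs ∎
  where open ≡-Reasoning

unchain-chain₁ : ∀ p → unchain (chain₁S p) ≡ p
unchain-chain₁ ε = refl
unchain-chain₁ (p ▷ unit) = trans (unchain-cons (nothing , ε) (chain₁S p)) (cong (λ u → u ++P (ε ▷ unit)) (unchain-chain₁ p))
unchain-chain₁ (p ▷ ext K q) = trans (unchain-cons (just K , q) (chain₁S p)) (cong (λ u → u ++P (ε ▷ ext K q)) (unchain-chain₁ p))

chain₂-Mseq : ∀ cs → All WellFormed cs → chain₂S (MseqS cs) ≡ cs
chain₂-Mseq [] [] = refl
chain₂-Mseq ((nothing , ε) ∷ cs) (wf-unit ∷ gs) =
  trans (cong (λ u → chain₂S (u ▷ unit)) (++P-identityˡ (MseqS cs))) (cong (_ ∷_) (chain₂-Mseq cs gs))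
chain₂-Mseq ((just K , s) ∷ cs) (wf-ext K s ∷ gs) = cong (_ ∷_) (chain₂-Mseq cs gs)

Mseq-chain₂ : ∀ q → MseqS (chain₂S q) ≡ q
Mseq-chain₂ ε = refl
Mseq-chain₂ (q ▷ unit) = trans (cong (_▷ unit) (++P-identityˡ _)) (cong (_▷ unit) (Mseq-chain₂ q))
Mseq-chain₂ (q ▷ ext K q') = cong (λ u → q ▷ ext K u) (Mseq-chain₂ q')

-- So ξ keeps
-- K and exchanges the roles of the part before and after it, and each role change
-- is inverted by the opposite one.
ξcoreS-form : ∀ p K q → ξcoreS (p ▷ ext K q) ≡ unchain (chain₂S q) ▷ ext K (MseqS (chain₁S p))
ξcoreS-form p K q = unchain-acc (chain₂S q) (ε ▷ ext K (MseqS (chain₁S p)))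

ξcore-inv : ∀ p K q → ξcoreS (ξcoreS (p ▷ ext K q)) ≡ p ▷ ext K q
ξcore-inv p K q = begin
    ξcoreS (ξcoreS (p ▷ ext K q))
  ≡⟨ cong ξcoreS (ξcoreS-form p K q) ⟩
    ξcoreS (unchain (chain₂S q) ▷ ext K (MseqS (chain₁S p)))
  ≡⟨ ξcoreS-form (unchain (chain₂S q)) K (MseqS (chain₁S p)) ⟩
    unchain (chain₂S (MseqS (chain₁S p))) ▷ ext K (MseqS (chain₁S (unchain (chain₂S q))))
  ≡⟨ cong₂ (λ u v → unchain u ▷ ext K (MseqS v)) (chain₂-Mseq _ (chain₁-wellFormed p)) (chain₁-unchain _ (chain₂-wellFormed q)) ⟩
    unchain (chain₁S p) ▷ ext K (MseqS (chain₂S q))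
  ≡⟨ cong₂ (λ u v → u ▷ ext K v) (unchain-chain₁ p) (Mseq-chain₂ q) ⟩
    p ▷ ext K q ∎
  where open ≡-Reasoning

ξS-inv : ∀ p → ξS (ξS p) ≡ p
ξS-inv p with view p
... | allUnits m = trans (cong ξS (ξS-units m)) (ξS-units m)
... | lastComponent p' K q m = begin
    ξS (ξS ((p' ▷ ext K q) ++P unitsP m))
  ≡⟨ cong ξS (ξS-++units (p' ▷ ext K q) m) ⟩
    ξS (ξcoreS (p' ▷ ext K q) ++P unitsP m)
  ≡⟨ ξS-++units (ξcoreS (p' ▷ ext K q)) m ⟩
    ξS (ξcoreS (p' ▷ ext K q)) ++P unitsP m
  ≡⟨ cong (λ u → ξS u ++P unitsP m) (ξcoreS-form p' K q) ⟩
    ξcoreS (unchain (chain₂S q) ▷ ext K (MseqS (chain₁S p'))) ++P unitsP m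
  ≡⟨ cong (_++P unitsP m) (trans (cong ξcoreS (sym (ξcoreS-form p' K q))) (ξcore-inv p' K q)) ⟩
    (p' ▷ ext K q) ++P unitsP m ∎
  where open ≡-Reasoning

headSize : Maybe Conn → ℕ
headSize nothing = 1
headSize (just K) = sizeC K + 1

chainSize : List Link → ℕ
chainSize [] = 0
chainSize ((m , s) ∷ cs) = size s + headSize m + chainSize cs

size-star : ∀ m M → size (star m M) ≡ headSize m + size M
size-star nothing M = +-comm (size M) 1
size-star (just K) M = move-M (sizeC⁻ K) (size M)
  where
  move-M : ∀ a x → suc (a + x + 1) ≡ suc a + 1 + x
  move-M = solve-∀

size-Mseq : ∀ cs → size (MseqS cs) ≡ chainSize cs
size-Mseq [] = refl
size-Mseq ((m , s) ∷ cs) = trans (size-++ s (star m (MseqS cs)))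
  (trans (cong (size s +_) (trans (size-star m (MseqS cs)) (cong (headSize m +_) (size-Mseq cs)))) (sym (+-assoc (size s) (headSize m) (chainSize cs))))

size-unchain : ∀ cs → size (unchain cs) ≡ chainSize cs
size-unchain [] = refl
size-unchain ((m , s) ∷ cs) = trans (cong size (unchain-cons (m , s) cs)) (trans (size-++ (unchain cs) (star m s))
  (trans (cong₂ _+_ (size-unchain cs) (size-star m s)) (reorder (chainSize cs) (headSize m) (size s))))
  where
  reorder : ∀ w m s → w + (m + s) ≡ s + m + w
  reorder = solve-∀

size-chain₁ : ∀ p → size p ≡ chainSize (chain₁S p)
size-chain₁ ε = refl
size-chain₁ (p ▷ unit) = trans (cong (_+ 1) (size-chain₁ p)) (+-comm _ 1)
size-chain₁ (p ▷ ext K q) = trans (cong (_+ sizeC (ext K q)) (size-chain₁ p)) (reorder _ (sizeC⁻ K) (size q))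
  where
  reorder : ∀ p a q → p + suc (a + q + 1) ≡ q + (suc a + 1) + p
  reorder = solve-∀

size-chain₂ : ∀ p → size p ≡ chainSize (chain₂S p)
size-chain₂ ε = refl
size-chain₂ (p ▷ unit) = trans (cong (_+ 1) (size-chain₂ p)) (+-comm _ 1)
size-chain₂ (p ▷ ext K q) = trans (cong (λ u → size p + suc (sizeC⁻ K + u + 1)) (size-chain₂ q)) (reassoc (size p) (sizeC⁻ K) _)
  where
  reassoc : ∀ p a w → p + suc (a + w + 1) ≡ p + (suc a + 1) + w
  reassoc = solve-∀

size-ξcore : ∀ p K q → size (ξcoreS (p ▷ ext K q)) ≡ size (p ▷ ext K q)
size-ξcore p K q = begin
    size (ξcoreS (p ▷ ext K q))
  ≡⟨ cong size (ξcoreS-form p K q) ⟩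
    size (unchain (chain₂S q)) + suc (sizeC⁻ K + size (MseqS (chain₁S p)) + 1)
  ≡⟨ cong₂ (λ u v → u + suc (sizeC⁻ K + v + 1)) (trans (size-unchain (chain₂S q)) (sym (size-chain₂ q))) (trans (size-Mseq (chain₁S p)) (sym (size-chain₁ p))) ⟩
    size q + suc (sizeC⁻ K + size p + 1)
  ≡⟨ swap-p-q (size p) (sizeC⁻ K) (size q) ⟩
    size (p ▷ ext K q) ∎
  where
  open ≡-Reasoning
  swap-p-q : ∀ p a q → q + suc (a + p + 1) ≡ p + suc (a + q + 1)
  swap-p-q = solve-∀

size-ξ : ∀ p → size (ξS p) ≡ size p
size-ξ ε = refl
size-ξ (p ▷ unit) = cong (_+ 1) (size-ξ p)
size-ξ (p ▷ ext K q) = size-ξcore p K q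

outerSize : Conn → ℕ
outerSize unit = 1
outerSize (ext K q) = suc (outerSize K)

mutual
  tyP : Term → List ℕ
  tyP ε = []
  tyP (p ▷ K) = tyP p ++ tyC K
  tyC : Conn → List ℕ
  tyC K = tyI K ++ [ outerSize K ]
  tyI : Conn → List ℕ
  tyI unit = []
  tyI (ext K q) = tyI K ++ tyP q

len-outer : ∀ K → length (outer K) ≡ outerSize K
len-outer unit = refl
len-outer (ext K q) = cong suc (trans (length-++ (otail K)) (trans (+-comm _ 1) (len-outer K)))

len-shift : ∀ c bs → map length (shift c bs) ≡ map length bs
len-shift c bs = trans (sym (map-∘ bs)) (map-cong (length-map (c +_)) bs)

mutual
  ty-den : ∀ p → map length (den p) ≡ tyP p
  ty-den ε = refl
  ty-den (p ▷ K) = trans (map-++ length (den p) _) (cong₂ _++_ (ty-den p) (trans (len-shift (size p) (denC K)) (ty-denC K)))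
  ty-denC : ∀ K → map length (denC K) ≡ tyC K
  ty-denC K = trans (map-++ length (inner K) _) (cong₂ (λ u v → u ++ [ v ]) (ty-inner K) (len-outer K))
  ty-inner : ∀ K → map length (inner K) ≡ tyI K
  ty-inner unit = refl
  ty-inner (ext K q) = trans (map-++ length (inner K) _) (cong₂ _++_ (ty-inner K) (trans (len-shift (sizeC K) (den q)) (ty-den q)))

ty-++P : ∀ X Y → tyP (X ++P Y) ≡ tyP X ++ tyP Y
ty-++P X ε = sym (++-identityʳ (tyP X))
ty-++P X (Y ▷ K) = trans (cong (_++ tyC K) (ty-++P X Y)) (++-assoc (tyP X) (tyP Y) (tyC K))

headType : Maybe Conn → List ℕ
headType nothing = [ 1 ]
headType (just K) = tyI K ++ [ suc (outerSize K) ]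

linkType : Link → List ℕ
linkType (m , s) = tyP s ++ headType m

chainType : List Link → List ℕ
chainType [] = []
chainType (c ∷ cs) = linkType c ++ chainType cs

ty-star : ∀ m M → tyP (star m M) ↭ headType m ++ tyP M
ty-star nothing M = ++-comm (tyP M) [ 1 ]
ty-star (just K) M = ↭-trans (↭-reflexive (++-assoc (tyI K) (tyP M) _))
  (↭-trans (++⁺ˡ (tyI K) (++-comm (tyP M) _)) (↭-reflexive (sym (++-assoc (tyI K) _ (tyP M)))))

ty-Mseq : ∀ cs → tyP (MseqS cs) ↭ chainType cs
ty-Mseq [] = ↭-refl
ty-Mseq ((m , s) ∷ cs) = ↭-trans (↭-reflexive (ty-++P s (star m (MseqS cs))))
  (↭-trans (++⁺ˡ (tyP s) (↭-trans (ty-star m (MseqS cs)) (++⁺ˡ (headType m) (ty-Mseq cs))))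
           (↭-reflexive (sym (++-assoc (tyP s) (headType m) (chainType cs)))))

ty-unchain : ∀ cs → tyP (unchain cs) ↭ chainType cs
ty-unchain [] = ↭-refl
ty-unchain ((m , s) ∷ cs) = ↭-trans (↭-reflexive (trans (cong tyP (unchain-cons (m , s) cs)) (ty-++P (unchain cs) (star m s))))
  (↭-trans (++⁺ (ty-unchain cs) (↭-trans (ty-star m s) (++-comm (headType m) (tyP s)))) (++-comm (chainType cs) _))

ty-chain₁ : ∀ p → tyP p ↭ chainType (chain₁S p)
ty-chain₁ ε = ↭-refl
ty-chain₁ (p ▷ unit) = ↭-trans (++-comm (tyP p) [ 1 ]) (++⁺ˡ [ 1 ] (ty-chain₁ p))
ty-chain₁ (p ▷ ext K q) = ↭-trans (++-comm (tyP p) _) (++⁺ e (ty-chain₁ p))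
  where
  e : (tyI K ++ tyP q) ++ [ suc (outerSize K) ] ↭ tyP q ++ (tyI K ++ [ suc (outerSize K) ])
  e = ↭-trans (↭-reflexive (++-assoc (tyI K) (tyP q) _)) (shifts (tyI K) (tyP q))

ty-chain₂ : ∀ p → tyP p ↭ chainType (chain₂S p)
ty-chain₂ ε = ↭-refl
ty-chain₂ (p ▷ unit) = ↭-trans (++-comm (tyP p) [ 1 ]) (++⁺ˡ [ 1 ] (ty-chain₂ p))
ty-chain₂ (p ▷ ext K q) = ↭-trans (++⁺ˡ (tyP p) e) (↭-trans (↭-reflexive (sym (++-assoc (tyP p) _ (tyP q)))) (++⁺ˡ (tyP p ++ (tyI K ++ [ suc (outerSize K) ])) (ty-chain₂ q)))
  where
  e : (tyI K ++ tyP q) ++ [ suc (outerSize K) ] ↭ (tyI K ++ [ suc (outerSize K) ]) ++ tyP q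
  e = ↭-trans (↭-reflexive (++-assoc (tyI K) (tyP q) _))
      (↭-trans (++⁺ˡ (tyI K) (++-comm (tyP q) _)) (↭-reflexive (sym (++-assoc (tyI K) _ (tyP q)))))

ty-ξcore : ∀ p K q → tyP (ξcoreS (p ▷ ext K q)) ↭ tyP (p ▷ ext K q)
ty-ξcore p K q = ↭-trans (↭-reflexive (cong tyP (ξcoreS-form p K q)))
  (↭-trans (++⁺ (↭-trans (ty-unchain (chain₂S q)) (↭-sym (ty-chain₂ q)))
                (++⁺ʳ [ s ] (++⁺ˡ (tyI K) (↭-trans (ty-Mseq (chain₁S p)) (↭-sym (ty-chain₁ p))))))
  (↭-trans (↭-reflexive (cong (tyP q ++_) (++-assoc (tyI K) (tyP p) [ s ])))
  (↭-trans (shifts (tyP q) (tyI K))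
  (↭-trans (++⁺ˡ (tyI K) (shifts (tyP q) (tyP p)))
  (↭-trans (shifts (tyI K) (tyP p))
           (↭-reflexive (cong (tyP p ++_) (sym (++-assoc (tyI K) (tyP q) [ s ])))))))))
  where s = suc (outerSize K)

ty-ξ : ∀ p → tyP (ξS p) ↭ tyP p
ty-ξ ε = ↭-refl
ty-ξ (p ▷ unit) = ++⁺ʳ [ 1 ] (ty-ξ p)
ty-ξ (p ▷ ext K q) = ty-ξcore p K q

type-den-ξ : ∀ p → type (den (ξS p)) ↭ type (den p)
type-den-ξ p = ↭-trans (↭-reflexive (ty-den (ξS p))) (↭-trans (ty-ξ p) (↭-reflexive (sym (ty-den p))))

-- Sizes of the nonnested blocks of den p: the outer blocks of its components.
nnSizes : Term → List ℕ
nnSizes ε = []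
nnSizes (p ▷ K) = nnSizes p ++ [ outerSize K ]

-- Sizes of the nonaligned blocks of den p: for a last component K * q these are
-- the nonaligned blocks of q followed by its outer block; a last singleton adds 1.
naSizes : Term → List ℕ
naSizes ε = []
naSizes (p ▷ unit) = naSizes p ++ [ 1 ]
naSizes (p ▷ ext K q) = naSizes q ++ [ outerSize (ext K q) ]

ones : ℕ → List ℕ
ones zero = []
ones (suc m) = ones m ++ [ 1 ]

nn-units : ∀ X m → nnSizes (X ++P unitsP m) ≡ nnSizes X ++ ones m
nn-units X zero = sym (++-identityʳ _)
nn-units X (suc m) = trans (cong (_++ [ 1 ]) (nn-units X m)) (++-assoc (nnSizes X) (ones m) [ 1 ])

na-units : ∀ X m → naSizes (X ++P unitsP m) ≡ naSizes X ++ ones m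
na-units X zero = sym (++-identityʳ _)
na-units X (suc m) = trans (cong (_++ [ 1 ]) (na-units X m)) (++-assoc (naSizes X) (ones m) [ 1 ])

na-Mseq-chain₁ : ∀ p → naSizes (MseqS (chain₁S p)) ≡ nnSizes p
na-Mseq-chain₁ ε = refl
na-Mseq-chain₁ (p ▷ unit) = trans (cong (λ u → naSizes (u ▷ unit)) (++P-identityˡ (MseqS (chain₁S p)))) (cong (_++ [ 1 ]) (na-Mseq-chain₁ p))
na-Mseq-chain₁ (p ▷ ext K q) = cong (_++ [ suc (outerSize K) ]) (na-Mseq-chain₁ p)

nn≡na-units : ∀ m → nnSizes (unitsP m) ≡ naSizes (unitsP m)
nn≡na-units zero = refl
nn≡na-units (suc m) = cong (_++ [ 1 ]) (nn≡na-units m)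

nn-na-ξ : ∀ p → nnSizes p ≡ naSizes (ξS p)
nn-na-ξ p with view p
... | allUnits m = trans (nn≡na-units m) (cong naSizes (sym (ξS-units m)))
... | lastComponent p' K q m = begin
    nnSizes ((p' ▷ ext K q) ++P unitsP m)
  ≡⟨ nn-units (p' ▷ ext K q) m ⟩
    (nnSizes p' ++ [ suc (outerSize K) ]) ++ ones m
  ≡⟨ cong (λ u → (u ++ [ suc (outerSize K) ]) ++ ones m) (sym (na-Mseq-chain₁ p')) ⟩
    naSizes (unchain (chain₂S q) ▷ ext K (MseqS (chain₁S p'))) ++ ones m
  ≡⟨ sym (na-units _ m) ⟩
    naSizes ((unchain (chain₂S q) ▷ ext K (MseqS (chain₁S p'))) ++P unitsP m)
  ≡⟨ cong (λ u → naSizes (u ++P unitsP m)) (sym (ξcoreS-form p' K q)) ⟩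
    naSizes (ξcoreS (p' ▷ ext K q) ++P unitsP m)
  ≡⟨ cong naSizes (sym (ξS-++units (p' ▷ ext K q) m)) ⟩
    naSizes (ξS ((p' ▷ ext K q) ++P unitsP m)) ∎
  where open ≡-Reasoning

na-nn-ξ : ∀ p → naSizes p ≡ nnSizes (ξS p)
na-nn-ξ p = trans (cong naSizes (sym (ξS-inv p))) (sym (nn-na-ξ (ξS p)))

-- The nonnested and nonaligned blocks of a denotation.

nestsOver : Block → ℕ × ℕ → Bool
nestsOver B e = (proj₁ e <ᵇ minB B) ∧ (maxB B <ᵇ proj₂ e)

isNonnested : List (ℕ × ℕ) → Block → Bool
isNonnested es B = not (any (nestsOver B) es)

endsBefore : Block → ℕ × ℕ → Bool
endsBefore B e = maxB B <ᵇ proj₁ e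

isNonaligned : List (ℕ × ℕ) → Block → Bool
isNonaligned es B = not (any (endsBefore B) es)

nestsOver-shift : ∀ c B e → B ≢ [] → nestsOver (map (c +_) B) (shiftEdge c e) ≡ nestsOver B e
nestsOver-shift c B (x , y) ne rewrite minB-shift c B ne | maxB-shift c B ne | <ᵇ-shift c x (minB B) | <ᵇ-shift c (maxB B) y = refl

endsBefore-shift : ∀ c B e → B ≢ [] → endsBefore (map (c +_) B) (shiftEdge c e) ≡ endsBefore B e
endsBefore-shift c B (x , y) ne rewrite maxB-shift c B ne | <ᵇ-shift c (maxB B) x = refl

isNonnested-shift : ∀ c bs B → B ≢ [] → isNonnested (edges (shift c bs)) (map (c +_) B) ≡ isNonnested (edges bs) B
isNonnested-shift c bs B ne = cong not (trans (cong (any _) (edges-shift c bs))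
  (trans (any-map _ (shiftEdge c) (edges bs)) (any-ext (λ e → nestsOver-shift c B e ne) (edges bs))))

isNonaligned-shift : ∀ c bs B → B ≢ [] → isNonaligned (edges (shift c bs)) (map (c +_) B) ≡ isNonaligned (edges bs) B
isNonaligned-shift c bs B ne = cong not (trans (cong (any _) (edges-shift c bs))
  (trans (any-map _ (shiftEdge c) (edges bs)) (any-ext (λ e → endsBefore-shift c B e ne) (edges bs))))

filter-shift : ∀ (F : List (ℕ × ℕ) → Block → Bool) → (∀ c bs B → B ≢ [] → F (edges (shift c bs)) (map (c +_) B) ≡ F (edges bs) B) →
  ∀ c bs → NonEmptyAll bs → filterᵇ (F (edges (shift c bs))) (shift c bs) ≡ shift c (filterᵇ (F (edges bs)) bs)
filter-shift F inv c bs ne = trans (filterᵇ-map _ (map (c +_)) bs) (cong (shift c) (filterᵇ-cong bs (All-map (λ {B} n → inv c bs B n) ne)))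

NestsOver : Block → ℕ × ℕ → Set
NestsOver B e = (proj₁ e < minB B) × (maxB B < proj₂ e)

nestsOver-true : ∀ B e → NestsOver B e → nestsOver B e ≡ true
nestsOver-true B e (a , b) rewrite <ᵇ-true a | <ᵇ-true b = refl

lift-denC : ∀ {e} K q → e ∈ edges (denC K) → e ∈ edges (denC (ext K q))
lift-denC {e} K q m with edges-++ (inner K) [ outer K ] m
... | inj₁ m1 = edges-++ˡ (inner K ++ shift (sizeC K) (den q)) _ (edges-++ˡ (inner K) _ m1)
... | inj₂ m1 with ∈-++⁻ (consec (outer K)) m1
...   | inj₁ m2 = edges-++ʳ (inner K ++ shift (sizeC K) (den q)) _ (∈-++⁺ˡ (consec-sub 1 (otail K) _ m2))
...   | inj₂ ()

closing-edge∈ : ∀ K q → (sizeC K , sizeC (ext K q)) ∈ edges (denC (ext K q))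
closing-edge∈ K q = edges-++ʳ (inner K ++ shift (sizeC K) (den q)) _
  (∈-++⁺ˡ (subst (λ v → (v , sizeC (ext K q)) ∈ consec (outer (ext K q))) (last-outer K) (consec-last 1 (otail K) _)))

inner-nested : ∀ K → All (λ B → Σ (ℕ × ℕ) (λ e → e ∈ edges (denC K) × NestsOver B e)) (inner K)
inner-nested unit = []
inner-nested (ext K q) = AllP.++⁺ (All-map (λ { (e , m , np) → e , lift-denC K q m , np }) (inner-nested K))
  (go (shift (sizeC K) (den q)) (InRange-shift (sizeC K) (den-range q)) (NonEmptyAll-shift (sizeC K) (den-nonempty q)))
  where
  sK = sizeC K
  n = sizeC (ext K q)
  go : ∀ bs → InRange (sK + 1) (sK + size q) bs → NonEmptyAll bs → All (λ B → Σ (ℕ × ℕ) (λ e → e ∈ edges (denC (ext K q)) × NestsOver B e)) bs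
  go [] [] [] = []
  go (B ∷ bs) (r ∷ rs) (ne ∷ nes) =
    ((sK , n) , closing-edge∈ K q ,
      (subst (_≤ minB B) (+-comm sK 1) (proj₁ (minB-Between B ne r)) ,
       s≤s (≤-trans (proj₂ (maxB-Between B ne r)) (≤-reflexive (sizeC-ext K q))))) ∷ go bs rs nes

minB-outer : ∀ K → minB (outer K) ≡ 1
minB-outer K = minB-head 1 (otail K) (All-map (λ i → ≤-trans (s≤s z≤n) (proj₁ i)) (otail-range K))

denC-nonnested : ∀ K → filterᵇ (isNonnested (edges (denC K))) (denC K) ≡ [ outer K ]
denC-nonnested K = trans (filterᵇ-++ _ (inner K) [ outer K ])
  (cong₂ _++_ (filterᵇ-none _ (inner K) (All-map (λ { {B} (e , m , np) → cong not (any-true (nestsOver B) _ m (nestsOver-true B e np)) }) (inner-nested K)))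
              (filterᵇ-all (isNonnested (edges (denC K))) [ outer K ] (outer-ok ∷ [])))
  where
  outer-ok : isNonnested (edges (denC K)) (outer K) ≡ true
  outer-ok = cong not (any-false (nestsOver (outer K)) (edges (denC K)) (λ {e} m →
    subst (λ v → ((proj₁ e <ᵇ v) ∧ (maxB (outer K) <ᵇ proj₂ e)) ≡ false) (sym (minB-outer K))
      (cong (_∧ (maxB (outer K) <ᵇ proj₂ e)) (<ᵇ-false (proj₁ (proj₁ (edges-range (denC K) (denC-range K) m)))))))

nnBlocksS : Term → List Block
nnBlocksS ε = []
nnBlocksS (p ▷ K) = nnBlocksS p ++ [ map (size p +_) (outer K) ]

den-nn : ∀ p → filterᵇ (isNonnested (edges (den p))) (den p) ≡ nnBlocksS p
den-nn ε = refl
den-nn (p ▷ K) = begin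
    filterᵇ (isNonnested (edges (den p ++ S))) (den p ++ S)
  ≡⟨ cong (λ es → filterᵇ (isNonnested es) (den p ++ S)) (edges-eq (den p) S) ⟩
    filterᵇ (isNonnested (E1 ++ E2)) (den p ++ S)
  ≡⟨ filterᵇ-++ _ (den p) S ⟩
    filterᵇ (isNonnested (E1 ++ E2)) (den p) ++ filterᵇ (isNonnested (E1 ++ E2)) S
  ≡⟨ cong₂ _++_ (filterᵇ-cong (den p) (part1 (den p) (den-range p) (den-nonempty p))) (filterᵇ-cong S (part2 S rS (NonEmptyAll-shift c (denC-nonempty K)))) ⟩
    filterᵇ (isNonnested E1) (den p) ++ filterᵇ (isNonnested E2) S
  ≡⟨ cong₂ _++_ (den-nn p) (trans (filter-shift isNonnested isNonnested-shift c (denC K) (denC-nonempty K)) (cong (shift c) (denC-nonnested K))) ⟩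
    nnBlocksS p ++ [ map (c +_) (outer K) ] ∎
  where
  open ≡-Reasoning
  c = size p
  S = shift c (denC K)
  E1 = edges (den p)
  E2 = edges S
  rS = InRange-shift c (denC-range K)
  part1 : ∀ bs → InRange 1 c bs → NonEmptyAll bs → All (λ B → isNonnested (E1 ++ E2) B ≡ isNonnested E1 B) bs
  part1 [] [] [] = []
  part1 (B ∷ bs) (r ∷ rs) (ne ∷ nes) = cong not (trans (any-++ _ E1 E2) (trans (cong (any (nestsOver B) E1 ∨_)
      (any-false (nestsOver B) E2 (λ {e} m → cong (_∧ (maxB B <ᵇ proj₂ e)) (<ᵇ-false (≤-trans (proj₂ (minB-Between B ne r))
          (≤-trans (n≤1+n c) (≤-trans (≤-reflexive (sym (+-comm c 1))) (proj₁ (proj₁ (edges-range S rS m))))))))))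
      (∨-identityʳ _))) ∷ part1 bs rs nes
  part2 : ∀ bs → InRange (c + 1) (c + sizeC K) bs → NonEmptyAll bs → All (λ B → isNonnested (E1 ++ E2) B ≡ isNonnested E2 B) bs
  part2 [] [] [] = []
  part2 (B ∷ bs) (r ∷ rs) (ne ∷ nes) = cong not (trans (any-++ _ E1 E2) (cong (_∨ any (nestsOver B) E2)
      (any-false _ E1 (λ {e} m → trans (cong ((proj₁ e <ᵇ minB B) ∧_) (<ᵇ-false
          (≤-trans (proj₂ (proj₂ (edges-range (den p) (den-range p) m))) (≤-trans (n≤1+n c) (≤-trans (≤-reflexive (sym (+-comm c 1))) (proj₁ (maxB-Between B ne r)))))))
          (∧-zeroʳ _))))) ∷ part2 bs rs nes

naBlocksS : Term → List Block
naBlocksS ε = []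
naBlocksS (p ▷ unit) = naBlocksS p ++ [ [ size p + 1 ] ]
naBlocksS (p ▷ ext K q) = shift (size p) (shift (sizeC K) (naBlocksS q) ++ [ outer (ext K q) ])

outer-edge-bound : ∀ {e} c K q → e ∈ edges [ map (c +_) (outer (ext K q)) ] → proj₁ e ≤ c + sizeC K
outer-edge-bound {e} c K q m with ∈-map⁻ (shiftEdge c) (subst (e ∈_) (consec-map c (outer (ext K q))) (subst (e ∈_) (++-identityʳ _) m))
... | e' , m' , refl with consec-snoc 1 (otail K) (sizeC (ext K q)) m'
...   | inj₁ m'' = +-monoʳ-≤ c (proj₂ (proj₁ (consec-range (outer K) (outer-range K) m'')))
...   | inj₂ refl = ≤-reflexive (cong (c +_) (last-outer K))

-- Nonaligned blocks of p ▷ K * q: the closing edge of the component starts after every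
-- block of p and of K, and nothing starts after the blocks of q except edges of q.
module NonalignedOfComponent (p : Term) (K : Conn) (q : Term) (ih : filterᵇ (isNonaligned (edges (den q))) (den q) ≡ naBlocksS q) where
  open ComponentDecomp p K q
  Eo = edges (den (p ▷ ext K q))
  A' = den p
  I' = shift c (inner K)
  Q' = shift (c + sK) (den q)
  EA = edges A'
  EI = edges I'
  EQ = edges Q'
  EB = edges [ Bl ]
  Eo-eq : Eo ≡ EA ++ (EI ++ (EQ ++ EB))
  Eo-eq = trans (cong edges bs-eq) (trans (edges-eq A' _) (cong (EA ++_) (trans (edges-eq I' _) (cong (EI ++_) (edges-eq Q' [ Bl ])))))
  closing-edge : (c + sK , n) ∈ Eo
  closing-edge = edges-++ʳ (den p) (shift c (denC (ext K q)))
            (subst ((c + sK , n) ∈_) (sym (edges-shift c (denC (ext K q)))) (∈-map⁺ (shiftEdge c) (closing-edge∈ K q)))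
  no-nonaligned : ∀ bs → All (λ B → maxB B < c + sK) bs → filterᵇ (isNonaligned Eo) bs ≡ []
  no-nonaligned bs h = filterᵇ-none (isNonaligned Eo) bs (All-map (λ {B} lt → cong not (any-true (endsBefore B) Eo closing-edge (<ᵇ-true lt))) h)
  below-closing-edge : ∀ {lo hi} bs → InRange lo hi bs → NonEmptyAll bs → hi < c + sK → All (λ B → maxB B < c + sK) bs
  below-closing-edge [] [] [] _ = []
  below-closing-edge (B ∷ bs) (r ∷ rs) (ne ∷ nes) lt = ≤-<-trans (proj₂ (maxB-Between B ne r)) lt ∷ below-closing-edge bs rs nes lt
  nonaligned-in-q : ∀ bs → InRange (c + sK + 1) (c + sK + b) bs → NonEmptyAll bs → All (λ B → isNonaligned Eo B ≡ isNonaligned EQ B) bs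
  nonaligned-in-q [] [] [] = []
  nonaligned-in-q (B ∷ bs) (r ∷ rs) (ne ∷ nes) = cong not same-any ∷ nonaligned-in-q bs rs nes
    where
    f = endsBefore B
    none : ∀ {es} → (∀ {e} → e ∈ es → proj₁ e ≤ c + sK) → any f es ≡ false
    none h = any-false f _ (λ m → <ᵇ-false (≤-trans (h m) (≤-trans (n≤1+n _)
               (≤-trans (≤-reflexive (sym (+-comm _ 1))) (proj₁ (maxB-Between B ne r))))))
    same-any : any f Eo ≡ any f EQ
    same-any = begin
        any f Eo
      ≡⟨ cong (any f) Eo-eq ⟩
        any f (EA ++ (EI ++ (EQ ++ EB)))
      ≡⟨ trans (any-++ f EA _) (cong (any f EA ∨_) (trans (any-++ f EI _) (cong (any f EI ∨_) (any-++ f EQ EB)))) ⟩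
        any f EA ∨ (any f EI ∨ (any f EQ ∨ any f EB))
      ≡⟨ cong₂ (λ u v → u ∨ (v ∨ (any f EQ ∨ any f EB)))
           (none (λ m → ≤-trans (proj₂ (proj₁ (edges-range A' (den-range p) m))) (m≤m+n c sK)))
           (none (λ m → ≤-trans (proj₂ (proj₁ (edges-range I' range-inner m))) (+-monoʳ-≤ c (n≤1+n a)))) ⟩
        any f EQ ∨ any f EB
      ≡⟨ cong (any f EQ ∨_) (none (outer-edge-bound c K q)) ⟩
        any f EQ ∨ false
      ≡⟨ ∨-identityʳ _ ⟩
        any f EQ ∎
      where open ≡-Reasoning
  maxBl-eq : maxB Bl ≡ n
  maxBl-eq = maxB-eq Bl (AllP.map⁺ (All-map (λ i → +-monoʳ-≤ c (proj₂ i)) (outer-range (ext K q)))) c∈'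
    where c∈' = ∈-map⁺ (c +_) (sizeC∈outer (ext K q))
  outer-nonaligned : isNonaligned Eo Bl ≡ true
  outer-nonaligned = cong not (any-false (endsBefore Bl) Eo (λ {e} m → <ᵇ-false (subst (proj₁ e ≤_) (sym maxBl-eq) (proj₂ (proj₁ (edges-range (den (p ▷ ext K q)) (den-range (p ▷ ext K q)) m))))))
  nonaligned-blocks : filterᵇ (isNonaligned Eo) (den (p ▷ ext K q)) ≡ naBlocksS (p ▷ ext K q)
  nonaligned-blocks = begin
      filterᵇ (isNonaligned Eo) (den (p ▷ ext K q))
    ≡⟨ cong (filterᵇ (isNonaligned Eo)) bs-eq ⟩
      filterᵇ (isNonaligned Eo) (A' ++ (I' ++ (Q' ++ [ Bl ])))
    ≡⟨ trans (filterᵇ-++ _ A' _) (cong (filterᵇ (isNonaligned Eo) A' ++_) (trans (filterᵇ-++ _ I' _) (cong (filterᵇ (isNonaligned Eo) I' ++_) (filterᵇ-++ _ Q' [ Bl ])))) ⟩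
      filterᵇ (isNonaligned Eo) A' ++ (filterᵇ (isNonaligned Eo) I' ++ (filterᵇ (isNonaligned Eo) Q' ++ filterᵇ (isNonaligned Eo) [ Bl ]))
    ≡⟨ cong₂ _++_ (no-nonaligned A' (below-closing-edge A' (den-range p) (den-nonempty p) (≤-<-trans (m≤m+n c a) (+-monoʳ-< c ≤-refl))))
        (cong₂ _++_ (no-nonaligned I' (below-closing-edge I' range-inner (NonEmptyAll-shift c (inner-nonempty K)) (+-monoʳ-< c ≤-refl)))
          (cong₂ _++_ (filterᵇ-cong Q' (nonaligned-in-q Q' range-q (NonEmptyAll-shift (c + sK) (den-nonempty q)))) (filterᵇ-all (isNonaligned Eo) [ Bl ] (outer-nonaligned ∷ [])))) ⟩
      filterᵇ (isNonaligned EQ) Q' ++ [ Bl ]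
    ≡⟨ cong (_++ [ Bl ]) (trans (filter-shift isNonaligned isNonaligned-shift (c + sK) (den q) (den-nonempty q)) (cong (shift (c + sK)) ih)) ⟩
      shift (c + sK) (naBlocksS q) ++ [ Bl ]
    ≡⟨ cong (_++ [ Bl ]) (sym (shift-shift c sK (naBlocksS q))) ⟩
      shift c (shift sK (naBlocksS q)) ++ [ Bl ]
    ≡⟨ sym (shift-++ c (shift sK (naBlocksS q)) _) ⟩
      naBlocksS (p ▷ ext K q) ∎
    where open ≡-Reasoning

den-na : ∀ p → filterᵇ (isNonaligned (edges (den p))) (den p) ≡ naBlocksS p
den-na ε = refl
den-na (p ▷ unit) = begin
    filterᵇ (isNonaligned (edges (den p ++ [ [ c + 1 ] ]))) (den p ++ [ [ c + 1 ] ])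
  ≡⟨ cong (λ es → filterᵇ (isNonaligned es) (den p ++ [ [ c + 1 ] ])) (trans (edges-eq (den p) _) (++-identityʳ _)) ⟩
    filterᵇ (isNonaligned (edges (den p))) (den p ++ [ [ c + 1 ] ])
  ≡⟨ filterᵇ-++ _ (den p) _ ⟩
    filterᵇ (isNonaligned (edges (den p))) (den p) ++ filterᵇ (isNonaligned (edges (den p))) [ [ c + 1 ] ]
  ≡⟨ cong₂ _++_ (den-na p) (filterᵇ-all (isNonaligned (edges (den p))) [ [ c + 1 ] ] (ok ∷ [])) ⟩
    naBlocksS p ++ [ [ c + 1 ] ] ∎
  where
  open ≡-Reasoning
  c = size p
  ok : isNonaligned (edges (den p)) [ c + 1 ] ≡ true
  ok = cong not (any-false _ (edges (den p)) (λ m → <ᵇ-false (≤-trans (proj₂ (proj₁ (edges-range (den p) (den-range p) m)))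
         (≤-trans (m≤m+n c 1) (≤-reflexive (sym (⊔-identityʳ (c + 1))))))))
den-na (p ▷ ext K q) = NonalignedOfComponent.nonaligned-blocks p K q (den-na q)

sizes-nnBlocksS : ∀ p → map length (nnBlocksS p) ≡ nnSizes p
sizes-nnBlocksS ε = refl
sizes-nnBlocksS (p ▷ K) = begin
    map length (nnBlocksS p ++ [ map (size p +_) (outer K) ])
  ≡⟨ map-++ length (nnBlocksS p) _ ⟩
    map length (nnBlocksS p) ++ [ length (map (size p +_) (outer K)) ]
  ≡⟨ cong₂ (λ u v → u ++ [ v ]) (sizes-nnBlocksS p) (trans (length-map (size p +_) (outer K)) (len-outer K)) ⟩
    nnSizes p ++ [ outerSize K ] ∎
  where open ≡-Reasoning

sizes-naBlocksS : ∀ p → map length (naBlocksS p) ≡ naSizes p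
sizes-naBlocksS ε = refl
sizes-naBlocksS (p ▷ unit) = trans (map-++ length (naBlocksS p) _) (cong (_++ [ 1 ]) (sizes-naBlocksS p))
sizes-naBlocksS (p ▷ ext K q) = begin
    map length (shift (size p) (shift (sizeC K) (naBlocksS q) ++ [ outer (ext K q) ]))
  ≡⟨ len-shift (size p) _ ⟩
    map length (shift (sizeC K) (naBlocksS q) ++ [ outer (ext K q) ])
  ≡⟨ map-++ length (shift (sizeC K) (naBlocksS q)) _ ⟩
    map length (shift (sizeC K) (naBlocksS q)) ++ [ length (outer (ext K q)) ]
  ≡⟨ cong₂ (λ u v → u ++ [ v ]) (trans (len-shift (sizeC K) (naBlocksS q)) (sizes-naBlocksS q)) (len-outer (ext K q)) ⟩
    naSizes q ++ [ outerSize (ext K q) ] ∎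
  where open ≡-Reasoning

sizes-nnBlocks-den : ∀ p → map length (nnBlocks (den p)) ≡ nnSizes p
sizes-nnBlocks-den p = trans (cong (map length) (den-nn p)) (sizes-nnBlocksS p)

sizes-naBlocks-den : ∀ p → map length (naBlocks (den p)) ≡ naSizes p
sizes-naBlocks-den p = trans (cong (map length) (den-na p)) (sizes-naBlocksS p)

-- Every noncrossing partition is the denotation of a term.

module NCFacts {n : ℕ} {bs : List Block} (nc : IsNC n bs) where
  open IsNC nc public
  open IsPartition partition public
  cov→ : ∀ {i} → i ∈ concat bs → (1 ≤ i) × (i ≤ n)
  cov→ {i} m = Equivalence.to (covers i) m
  cov← : ∀ {i} → 1 ≤ i → i ≤ n → i ∈ concat bs
  cov← {i} a b = Equivalence.from (covers i) (a , b)
  inBlk : ∀ {x C} → C ∈ bs → x ∈ C → (1 ≤ x) × (x ≤ n)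
  inBlk mC mx = cov→ (∈-concat⁺′ mx mC)
  sorted : AllPairs (λ C D → maxB C < maxB D) bs
  sorted = APP.map⁻ ordered
  eOf : ∀ {e C} → C ∈ bs → e ∈ consec C → e ∈ edges bs
  eOf = edge-of bs

module LastBlock {n : ℕ} (π' : List Block) (B : Block) (nc : IsNC n (π' ++ [ B ])) where
  open NCFacts nc public
  π = π' ++ [ B ]
  u : Unique (concat π' ++ (B ++ []))
  u = subst Unique (sym (concat-++ π' [ B ])) disjoint
  notBoth : ∀ {x} → x ∈ concat π' → x ∈ B → ⊥
  notBoth mx mB = Unique-disjoint (concat π') (B ++ []) u mx (∈-++⁺ˡ mB)
  B∈ : B ∈ π
  B∈ = ∈-++⁺ʳ π' (here refl)
  π'∈ : ∀ {C} → C ∈ π' → C ∈ π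
  π'∈ m = ∈-++⁺ˡ m
  lastBig : All (λ C → maxB C < maxB B) π'
  lastBig = AllPairs-last π' B sorted
  Bne : B ≢ []
  Bne = All.lookup nonempty B∈
  n≥1 : 1 ≤ n
  n≥1 = let r = inBlk B∈ (maxB∈ B Bne) in ≤-trans (proj₁ r) (proj₂ r)
  allB≤ : All (_≤ n) B
  allB≤ = All.tabulate (λ m → proj₂ (inBlk B∈ m))
  maxB≤ : ∀ {C} → C ∈ π → maxB C ≤ n
  maxB≤ {C} mC = maxB-≤ C (All.tabulate (λ m → proj₂ (inBlk mC m)))
  n∈B : n ∈ B
  n∈B with ∈-concat⁻′ π (cov← n≥1 ≤-refl)
  ... | C , nC , mC with ∈-++⁻ π' mC
  ...   | inj₂ (here refl) = nC
  ...   | inj₁ mC' = ⊥-elim (<⇒≱ (All.lookup lastBig mC') (≤-trans (maxB≤ B∈) (∈-≤maxB C nC)))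
  Bsplit : Σ (List ℕ) (λ B' → B ≡ B' ++ [ n ])
  Bsplit = increasing-snoc B (All.lookup increasing B∈) n∈B allB≤

single-NC : ∀ {n'} π' → IsNC (suc n') (π' ++ [ [ suc n' ] ]) → IsNC n' π'
single-NC {n'} π' nc = record
  { partition = record
    { nonempty = AllP.++⁻ˡ π' nonempty
    ; increasing = AllP.++⁻ˡ π' increasing
    ; ordered = AllPairs-prefix (map maxB π') _ (subst (AllPairs _<_) (map-++ maxB π' _) ordered)
    ; disjoint = AllPairs-prefix (concat π') _ u
    ; covers = λ i → mk⇔ (to i) (from i) }
  ; noncrossing = λ m1 m2 → noncrossing (edges-++ˡ π' _ m1) (edges-++ˡ π' _ m2) }
  where
  open LastBlock π' [ suc n' ] nc
  to : ∀ i → i ∈ concat π' → (1 ≤ i) × (i ≤ n')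
  to i m with cov→ (subst (i ∈_) (sym (sym (concat-++ π' [ _ ]))) (∈-++⁺ˡ m))
  ... | a , b with m≤n⇒m<n∨m≡n b
  ...   | inj₁ lt = a , ≤-pred lt
  ...   | inj₂ refl = ⊥-elim (notBoth m (here refl))
  from : ∀ i → (1 ≤ i) × (i ≤ n') → i ∈ concat π'
  from i (a , b) with ∈-++⁻ (concat π') (subst (i ∈_) (sym (concat-++ π' [ _ ])) (cov← a (m≤n⇒m≤1+n b)))
  ... | inj₁ m = m
  ... | inj₂ (here refl) = ⊥-elim (<-irrefl refl b)

-- The decomposition π = σ ⊎ (τ * υ) at the block B' ++ [ n ] of n, where b is the
-- last point of B'.  Noncrossing forces every other block to lie entirely left of b
-- (the list L) or strictly between b and n (the list Q).  Then L ++ [ B' ] ∈ NC(b)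
-- and Q, renumbered, ∈ NC(n - 1 - b); from terms for them we rebuild π.
module SplitLastBlock {n' : ℕ} (π' : List Block) (x : ℕ) (xs : List ℕ) (nc : IsNC (suc n') (π' ++ [ (x ∷ xs) ++ [ suc n' ] ])) where
  n = suc n'
  B' = x ∷ xs
  B = B' ++ [ n ]
  open LastBlock π' B nc
  incB : AllPairs _<_ B
  incB = All.lookup increasing B∈
  incB' : AllPairs _<_ B'
  incB' = AllPairs-prefix B' [ n ] incB
  b = last x xs
  allB'≤b : All (_≤ b) B'
  allB'≤b = proj₁ (last-max x xs incB')
  b∈B' : b ∈ B'
  b∈B' = proj₂ (last-max x xs incB')
  B'<n : All (_< n) B'
  B'<n = AllPairs-last B' n incB
  b<n : b < n
  b<n = All.lookup B'<n b∈B'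
  b≤n' : b ≤ n'
  b≤n' = ≤-pred b<n
  b∈B : b ∈ B
  b∈B = ∈-++⁺ˡ b∈B'
  maxB'≡b : maxB B' ≡ b
  maxB'≡b = maxB-eq B' allB'≤b b∈B'
  edge-b-n : (b , n) ∈ edges π
  edge-b-n = eOf B∈ (consec-last x xs n)
  noMaxb : All (λ C → maxB C ≢ b) π'
  noMaxb = All.tabulate (λ {C} mC eq → notBoth (∈-concat⁺′ (subst (_∈ C) eq (maxB∈ C (All.lookup nonempty (π'∈ mC)))) mC) b∈B)
  split = split-sorted b π' (AllPairs-prefix π' [ B ] sorted) noMaxb
  L = proj₁ split
  Q = proj₁ (proj₂ split)
  eqπ' : π' ≡ L ++ Q
  eqπ' = proj₁ (proj₂ (proj₂ split))
  aL : All (λ C → maxB C < b) L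
  aL = proj₁ (proj₂ (proj₂ (proj₂ split)))
  aQ : All (λ C → b < maxB C) Q
  aQ = proj₂ (proj₂ (proj₂ (proj₂ split)))
  L∈ : ∀ {C} → C ∈ L → C ∈ π'
  L∈ m = subst (_ ∈_) (sym eqπ') (∈-++⁺ˡ m)
  Q∈ : ∀ {C} → C ∈ Q → C ∈ π'
  Q∈ m = subst (_ ∈_) (sym eqπ') (∈-++⁺ʳ L m)
  b∉ : ∀ {C} → C ∈ π' → b ∈ C → ⊥
  b∉ mC mb = notBoth (∈-concat⁺′ mb mC) b∈B
  -- Noncrossing with the edge (b , n): every block of Q lies in [b + 1, n - 1].
  Q-between : ∀ {C} → C ∈ Q → All (Between (suc b) n') C
  Q-between {C} mQ = go C refl
    where
    mC = π'∈ (Q∈ mQ)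
    mxC<n : maxB C < n
    mxC<n = subst (maxB C <_) (maxB-eq B allB≤ n∈B) (All.lookup lastBig (Q∈ mQ))
    go : ∀ D → D ≡ C → All (Between (suc b) n') D
    go [] refl = ⊥-elim (All.lookup nonempty mC refl)
    go (z ∷ zs) refl with <-cmp z b
    ... | tri≈ _ eq _ = ⊥-elim (b∉ (Q∈ mQ) (here (sym eq)))
    ... | tri> _ _ bz = All.tabulate (λ {e} m → ≤-trans bz (All.lookup (head-min z zs (All.lookup increasing mC)) m) , ≤-pred (≤-<-trans (∈-≤maxB (z ∷ zs) m) mxC<n))
    ... | tri< zb _ _ = ⊥-elim (noncrossing (eOf mC me) edge-b-n (ub , bv , ≤-<-trans vle mxC<n))
      where
      y = maxB (z ∷ zs)
      by : b < y
      by = All.lookup aQ mQ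
      y∈zs : y ∈ zs
      y∈zs with maxB∈ (z ∷ zs) (λ ())
      ... | here eq = ⊥-elim (<-asym zb (subst (b <_) eq by))
      ... | there m = m
      nbs : All (_≢ b) zs
      nbs = All.tabulate (λ m eq → b∉ (Q∈ mQ) (there (subst (_∈ zs) eq m)))
      cg = cross-gap z zs (All.lookup increasing mC) zb y∈zs by nbs
      me = proj₁ (proj₂ cg)
      ub = proj₁ (proj₂ (proj₂ cg))
      bv = proj₂ (proj₂ (proj₂ cg))
      vle : proj₂ (proj₁ cg) ≤ y
      vle = proj₂ (consec-range (z ∷ zs) (All.tabulate (λ m → ∈-≤maxB (z ∷ zs) m)) me)

  concatπ : concat π ≡ concat L ++ (concat Q ++ (B ++ []))
  concatπ = trans (sym (concat-++ π' [ B ])) (trans (cong (λ v → concat v ++ (B ++ [])) eqπ')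
            (trans (cong (_++ (B ++ [])) (sym (concat-++ L Q))) (++-assoc (concat L) (concat Q) _)))
  uπ : Unique (concat L ++ (concat Q ++ (B ++ [])))
  uπ = subst Unique concatπ disjoint
  L-below : ∀ {C e} → C ∈ L → e ∈ C → e < b
  L-below {C} mL me = ≤-<-trans (∈-≤maxB C me) (All.lookup aL mL)
  edgesπ'→ : ∀ {e} → e ∈ edges π' → e ∈ edges π
  edgesπ'→ m = edges-++ˡ π' _ m
  edgesL→ : ∀ {e} → e ∈ edges L → e ∈ edges π
  edgesL→ m = edgesπ'→ (subst (λ v → _ ∈ edges v) (sym eqπ') (edges-++ˡ L Q m))
  edgesQ→ : ∀ {e} → e ∈ edges Q → e ∈ edges π
  edgesQ→ m = edgesπ'→ (subst (λ v → _ ∈ edges v) (sym eqπ') (edges-++ʳ L Q m))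
  sortedLQ : SortedB (L ++ Q)
  sortedLQ = subst SortedB eqπ' (AllPairs-prefix π' [ B ] sorted)

  data Loc (i : ℕ) : Set where
    inL : ∀ {C} → C ∈ L → i ∈ C → Loc i
    inQ : ∀ {C} → C ∈ Q → i ∈ C → Loc i
    inB' : i ∈ B' → Loc i
    isN : i ≡ n → Loc i
  locate : ∀ {i} → 1 ≤ i → i ≤ n → Loc i
  locate a c with ∈-concat⁻′ π (cov← a c)
  ... | C , iC , mC with ∈-++⁻ π' mC
  ...   | inj₂ (here refl) with ∈-++⁻ B' iC
  ...     | inj₁ m = inB' m
  ...     | inj₂ (here eq) = isN eq
  locate a c | C , iC , mC | inj₁ m' with ∈-++⁻ L (subst (C ∈_) eqπ' m')
  ...     | inj₁ mL = inL mL iC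
  ...     | inj₂ mQ = inQ mQ iC

  σ-NC : IsNC b (L ++ [ B' ])
  σ-NC = record
    { partition = record
      { nonempty = AllP.++⁺ (All.tabulate (λ m → All.lookup nonempty (π'∈ (L∈ m)))) ((λ ()) ∷ [])
      ; increasing = AllP.++⁺ (All.tabulate (λ m → All.lookup increasing (π'∈ (L∈ m)))) (incB' ∷ [])
      ; ordered = subst (AllPairs _<_) (sym (map-++ maxB L [ B' ]))
          (subst (λ v → AllPairs _<_ (map maxB L ++ [ v ])) (sym maxB'≡b)
            (APP.++⁺ (APP.map⁺ (AllPairs-prefix L Q sortedLQ)) ([] ∷ []) (AllP.map⁺ (All-map (λ lt → lt ∷ []) aL))))
      ; disjoint = subst Unique (sym (sym (concat-++ L [ B' ]))) uσ
      ; covers = λ i → mk⇔ (to i) (from i) }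
    ; noncrossing = λ m1 m2 → noncrossing (eσ m1) (eσ m2) }
    where
    uσ : Unique (concat L ++ (B' ++ []))
    uσ = AllPairs-prefix (concat L ++ (B' ++ [])) [ n ] (subst Unique e (AllPairs-dropMiddle (concat L) (concat Q) (B ++ []) uπ))
      where
      e : concat L ++ (B ++ []) ≡ (concat L ++ (B' ++ [])) ++ [ n ]
      e = trans (cong (concat L ++_) (trans (++-identityʳ B) (cong (_++ [ n ]) (sym (++-identityʳ B')))))
                (sym (++-assoc (concat L) (B' ++ []) [ n ]))
    eσ : ∀ {e} → e ∈ edges (L ++ [ B' ]) → e ∈ edges π
    eσ m with edges-++ L [ B' ] m
    ... | inj₁ m1 = edgesL→ m1
    ... | inj₂ m1 with ∈-++⁻ (consec B') m1
    ...   | inj₁ m2 = eOf B∈ (consec-sub x xs n m2)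
    ...   | inj₂ ()
    to : ∀ i → i ∈ concat (L ++ [ B' ]) → (1 ≤ i) × (i ≤ b)
    to i m with ∈-++⁻ (concat L) (subst (i ∈_) (sym (concat-++ L [ B' ])) m)
    ... | inj₁ m1 with ∈-concat⁻′ L m1
    ...   | C , iC , mL = proj₁ (inBlk (π'∈ (L∈ mL)) iC) , <⇒≤ (L-below mL iC)
    to i m | inj₂ m1 with ∈-++⁻ B' m1
    ...   | inj₁ m2 = proj₁ (inBlk B∈ (∈-++⁺ˡ m2)) , All.lookup allB'≤b m2
    ...   | inj₂ ()
    from : ∀ i → (1 ≤ i) × (i ≤ b) → i ∈ concat (L ++ [ B' ])
    from i (a , c) with locate a (≤-trans c (<⇒≤ b<n))
    ... | inL mL iC = ∈-concat⁺′ iC (∈-++⁺ˡ mL)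
    ... | inQ mQ iC = ⊥-elim (<⇒≱ (proj₁ (All.lookup (Q-between mQ) iC)) c)
    ... | inB' m = ∈-concat⁺′ m (∈-++⁺ʳ L (here refl))
    ... | isN refl = ⊥-elim (<⇒≱ b<n c)

  m = n' ∸ b
  n'≡ : n' ≡ b + m
  n'≡ = sym (m+[n∸m]≡n b≤n')
  Q' = map (map (_∸ b)) Q
  Qb : All (All (b ≤_)) Q
  Qb = All.tabulate (λ mQ → All-map (λ r → ≤-trans (n≤1+n b) (proj₁ r)) (Q-between mQ))
  shQ : shift b Q' ≡ Q
  shQ = shift-unshift b Q Qb
  NEQ' : NonEmptyAll Q'
  NEQ' = AllP.map⁺ (All.tabulate (λ {C} mQ → ne C (All.lookup nonempty (π'∈ (Q∈ mQ)))))
    where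
    ne : ∀ C → C ≢ [] → map (_∸ b) C ≢ []
    ne [] h = ⊥-elim (h refl)
    ne (_ ∷ _) _ ()
  concatQ : concat Q ≡ map (b +_) (concat Q')
  concatQ = trans (cong concat (sym shQ)) (concat-map Q')
  τ-NC : IsNC m Q'
  τ-NC = record
    { partition = record
      { nonempty = NEQ'
      ; increasing = AllP.map⁺ (All.tabulate (λ {C} mQ → increasing-unshift b C (All.lookup Qb mQ) (All.lookup increasing (π'∈ (Q∈ mQ)))))
      ; ordered = APP.map⁺ (sorted-unshift b Q' (subst SortedB (sym shQ) (AllPairs-suffix L Q sortedLQ)) NEQ')
      ; disjoint = UP.map⁻ (subst Unique concatQ (AllPairs-prefix (concat Q) (B ++ []) (AllPairs-suffix (concat L) _ uπ)))
      ; covers = λ i → mk⇔ (to i) (from i) }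
    ; noncrossing = λ m1 m2 (ac , cb , bd) → noncrossing (eτ m1) (eτ m2) (+-monoʳ-< b ac , +-monoʳ-< b cb , +-monoʳ-< b bd) }
    where
    eτ : ∀ {e} → e ∈ edges Q' → shiftEdge b e ∈ edges π
    eτ {e} m = edgesQ→ (subst (λ v → shiftEdge b e ∈ edges v) shQ (subst (shiftEdge b e ∈_) (sym (edges-shift b Q')) (∈-map⁺ (shiftEdge b) m)))
    to : ∀ i → i ∈ concat Q' → (1 ≤ i) × (i ≤ m)
    to i mi with ∈-concat⁻′ Q (subst (b + i ∈_) (sym concatQ) (∈-map⁺ (b +_) mi))
    ... | C , iC , mQ with All.lookup (Q-between mQ) iC
    ...   | lo , hi = +-cancelˡ-≤ b 1 i (subst (_≤ b + i) (sym (+-comm b 1)) lo) , +-cancelˡ-≤ b i m (subst (b + i ≤_) n'≡ hi)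
    from : ∀ i → (1 ≤ i) × (i ≤ m) → i ∈ concat Q'
    from i (a , c) with locate (≤-trans a (m≤n+m i b)) (≤-trans (subst (b + i ≤_) (sym n'≡) (+-monoʳ-≤ b c)) (n≤1+n n'))
    ... | inL mL iC = ⊥-elim (<⇒≱ (L-below mL iC) (m≤m+n b i))
    ... | inB' mB = ⊥-elim (<⇒≱ (≤-trans (≤-reflexive (sym (+-comm b 1))) (+-monoʳ-≤ b a)) (All.lookup allB'≤b mB))
    ... | isN eq = ⊥-elim (1+n≰n (subst (_≤ n') eq (subst (b + i ≤_) (sym n'≡) (+-monoʳ-≤ b c))))
    ... | inQ mQ iC with ∈-map⁻ (b +_) (subst (b + i ∈_) concatQ (∈-concat⁺′ iC mQ))
    ...   | j , mj , eq = subst (_∈ concat Q') (sym (+-cancelˡ-≡ b i j eq)) mj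

  snoc≢[] : ∀ {A : Set} (xs : List A) y → xs ++ [ y ] ≢ []
  snoc≢[] [] y ()
  snoc≢[] (_ ∷ _) y ()

  -- Terms for σ = L ++ [ B' ] and υ = Q' give the term (p0 ▷ K * υ) for π, where
  -- p0 ▷ K is the term of σ (its last component K carries the block B').
  rebuild : ∀ p1 q → size p1 ≡ b → den p1 ≡ L ++ [ B' ] → size q ≡ m → den q ≡ Q' →
          Σ Term (λ p → (size p ≡ n) × (den p ≡ π))
  rebuild ε q s1 d1 s2 d2 = ⊥-elim (snoc≢[] L B' (sym d1))
  rebuild (p0 ▷ K) q s1 d1 s2 d2 = p0 ▷ ext K q , sz , dn
    where
    c = size p0
    sK = sizeC K
    d1' : (den p0 ++ shift c (inner K)) ++ [ map (c +_) (outer K) ] ≡ L ++ [ B' ]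
    d1' = trans (++-assoc (den p0) (shift c (inner K)) [ map (c +_) (outer K) ]) (trans (cong (den p0 ++_) (sym (shift-++ c (inner K) [ outer K ]))) d1)
    inj = ∷ʳ-injective (den p0 ++ shift c (inner K)) L d1'
    size-rebuild : ∀ c a s → c + suc (a + s + 1) ≡ suc (c + suc a + s)
    size-rebuild = solve-∀
    sz : size (p0 ▷ ext K q) ≡ n
    sz = trans (size-rebuild c (sizeC⁻ K) (size q)) (cong suc (trans (cong₂ _+_ s1 s2) (sym n'≡)))
    dn : den (p0 ▷ ext K q) ≡ π
    dn = begin
        den (p0 ▷ ext K q)
      ≡⟨ ComponentDecomp.bs-eq p0 K q ⟩
        den p0 ++ (shift c (inner K) ++ (shift (c + sK) (den q) ++ [ ComponentDecomp.Bl p0 K q ]))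
      ≡⟨ sym (++-assoc (den p0) _ _) ⟩
        (den p0 ++ shift c (inner K)) ++ (shift (c + sK) (den q) ++ [ ComponentDecomp.Bl p0 K q ])
      ≡⟨ cong₂ (λ u v → u ++ (shift (c + sK) (den q) ++ [ v ])) (proj₁ inj) (ComponentDecomp.Bl-eq p0 K q) ⟩
        L ++ (shift (c + sK) (den q) ++ [ map (c +_) (outer K) ++ [ c + sizeC (ext K q) ] ])
      ≡⟨ cong₂ (λ u v → L ++ (u ++ [ v ])) (cong₂ shift s1 d2) (cong₂ (λ u v → u ++ [ v ]) (proj₂ inj) sz) ⟩
        L ++ (shift b Q' ++ [ B ])
      ≡⟨ cong (λ u → L ++ (u ++ [ B ])) shQ ⟩
        L ++ (Q ++ [ B ])
      ≡⟨ sym (++-assoc L Q [ B ]) ⟩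
        (L ++ Q) ++ [ B ]
      ≡⟨ cong (_++ [ B ]) (sym eqπ') ⟩
        π ∎
      where open ≡-Reasoning

  build : (∀ k ρ → k ≤ n' → IsNC k ρ → Σ Term (λ p → (size p ≡ k) × (den p ≡ ρ))) →
          Σ Term (λ p → (size p ≡ n) × (den p ≡ π))
  build ih with ih b (L ++ [ B' ]) b≤n' σ-NC | ih m Q' (m∸n≤m n' b) τ-NC
  ... | p1 , s1 , d1 | q , s2 , d2 = rebuild p1 q s1 d1 s2 d2

den-surjective : ∀ f n π → n ≤ f → IsNC n π → Σ Term (λ p → (size p ≡ n) × (den p ≡ π))
den-surjective f n π le nc with snoc-view π
den-surjective f zero π le nc | inj₁ refl = ε , refl , refl
den-surjective f (suc n') π le nc | inj₁ refl with NCFacts.cov← nc (s≤s z≤n) (s≤s z≤n)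
... | ()
den-surjective f zero π le nc | inj₂ (π' , B , refl) = ⊥-elim (<⇒≱ (LastBlock.n≥1 π' B nc) z≤n)
den-surjective zero (suc n') π () nc | inj₂ (π' , B , refl)
den-surjective (suc f) (suc n') π le nc | inj₂ (π' , B , refl) with LastBlock.Bsplit π' B nc
... | [] , refl with den-surjective f n' π' (≤-pred le) (single-NC π' nc)
...   | p' , s' , d' = p' ▷ unit , trans (cong (_+ 1) s') (+-comm n' 1) ,
                       trans (cong₂ (λ u v → u ++ [ [ v ] ]) d' (cong (_+ 1) s')) (cong (λ v → π' ++ [ [ v ] ]) (+-comm n' 1))
den-surjective (suc f) (suc n') π le nc | inj₂ (π' , B , refl) | (x ∷ xs) , refl =
  SplitLastBlock.build π' x xs nc (λ k ρ k≤n' → den-surjective f k ρ (≤-trans k≤n' (≤-pred le)))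

ξ-den : ∀ p → ξ (size p) (den p) ≡ den (ξS p)
ξ-den p = cong proj₂ (ξ-hom p)

ξ-den-twice : ∀ p → ξ (size p) (den (ξS p)) ≡ den p
ξ-den-twice p = begin
    ξ (size p) (den (ξS p))        ≡⟨ cong (λ v → ξ v (den (ξS p))) (sym (size-ξ p)) ⟩
    ξ (size (ξS p)) (den (ξS p))   ≡⟨ ξ-den (ξS p) ⟩
    den (ξS (ξS p))                ≡⟨ cong den (ξS-inv p) ⟩
    den p                          ∎
  where open ≡-Reasoning

length-from-sizes : ∀ {xs ys : List Block} → map length xs ≡ map length ys → length xs ≡ length ys
length-from-sizes {xs} {ys} e = trans (sym (length-map length xs)) (trans (cong length e) (length-map length ys))

nn-na-sizes : ∀ p → map length (nnBlocks (den p)) ≡ map length (naBlocks (den (ξS p)))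
nn-na-sizes p = trans (sizes-nnBlocks-den p) (trans (nn-na-ξ p) (sym (sizes-naBlocks-den (ξS p))))

na-nn-sizes : ∀ p → map length (naBlocks (den p)) ≡ map length (nnBlocks (den (ξS p)))
na-nn-sizes p = trans (sizes-naBlocks-den p) (trans (na-nn-ξ p) (sym (sizes-nnBlocks-den (ξS p))))

-- Theorem 5.4.  Every π is the denotation of a term p; all claims follow from the
-- syntactic ones above.
theorem5p4 : ∀ (n : ℕ) → 1 ≤ n → ∀ (π : List Block) → IsNC n π →
    IsNC n (ξ n π)
    × ξ n (ξ n π) ≡ π
    × type (ξ n π) ↭ type π
    × nn (ξ n π) ≡ na π
    × na (ξ n π) ≡ nn π
    × map length (nnBlocks π) ≡ map length (naBlocks (ξ n π))
    × map length (naBlocks π) ≡ map length (nnBlocks (ξ n π))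
theorem5p4 n _ π nc with den-surjective n n π ≤-refl nc
... | p , refl , refl rewrite ξ-den p =
    subst (λ v → IsNC v (den (ξS p))) (size-ξ p) (den-isNC (ξS p))
  , ξ-den-twice p
  , type-den-ξ p
  , length-from-sizes (sym (na-nn-sizes p))
  , length-from-sizes (sym (nn-na-sizes p))
  , nn-na-sizes p
  , na-nn-sizes p
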